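{- Let $G=\mathrm{NSG}(m_1,\ldots,m_h;n_1,\ldots,n_h)$ be a connected threshold graph. Then $$\mathrm{mul}(0,G)=\sum_{i=1}^h(m_i-1),\qquad \mathrm{mul}(-1,G)=\sum_{i=1}^h(n_i-1)+\begin{cases}1&\text{if } m_h=1,\\ 0&\text{if } m_h\ge 2.\end{cases}$$
   Context: All graphs are finite, simple and undirected; eigenvalues of a graph are those of its adjacency matrix, and $\mathrm{mul}(\lambda,G)$ denotes the multiplicity of $\lambda$ as an eigenvalue of $G$ (zero if $\lambda$ is not an eigenvalue). A threshold graph is a graph obtainable from a one-vertex graph by repeatedly adding an isolated vertex or a vertex adjacent to all existing vertices. Every connected threshold graph $G$ has its vertex set partitioned into nonempty sets $V_1,\ldots,V_h$ and nonempty sets $U_1,\ldots,U_h$ such that $V_1\cup\cdots\cup V_h$ is a clique, $U_1\cup\cdots\cup U_h$ is an independent set, and for each $i$ and each $u\in U_i$ the neighbourhood of $u$ is exactly $V_1\cup\cdots\cup V_i$. With $m_i=|U_i|$ and $n_i=|V_i|$, one writes $G=\mathrm{NSG}(m_1,\ldots,m_h;n_1,\ldots,n_h)$. -}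

module Defs where

open import Data.Nat as ℕ using (ℕ; zero; suc; _≤ᵇ_)
open import Data.Integer as ℤ using (ℤ; +_; -_)
open import Data.Fin as Fin using (Fin; toℕ; punchIn)
open import Data.Fin.Base using () renaming (zero to fz; suc to fs)
open import Data.List as List using (List; []; _∷_; replicate; _++_; concatMap; allFin; length; foldr; map)
open import Data.List.Base using (lookup)
open import Data.Nat.ListAction using (sum)
open import Data.Bool using (Bool; true; false; if_then_else_)
open import Relation.Nullary using (does)
open import Relation.Binary.PropositionalEquality using (_≡_)
open import Relation.Nullary using (¬_)
open import Data.Product using (Σ; _×_)

-- Polynomials over ℤ as little-endian coefficient lists
-- (trailing zeros allowed; equality is coefficientwise).

Poly : Set
Poly = List ℤ

coeff : Poly → ℕ → ℤ
coeff []       _       = + 0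
coeff (a ∷ p)  zero    = a
coeff (a ∷ p)  (suc i) = coeff p i

infix 4 _≈ₚ_
_≈ₚ_ : Poly → Poly → Set
p ≈ₚ q = ∀ i → coeff p i ≡ coeff q i

infixl 6 _+ₚ_
infixl 7 _*ₚ_ _·ₚ_

_+ₚ_ : Poly → Poly → Poly
[]      +ₚ q       = q
(a ∷ p) +ₚ []      = a ∷ p
(a ∷ p) +ₚ (b ∷ q) = (a ℤ.+ b) ∷ (p +ₚ q)

_·ₚ_ : ℤ → Poly → Poly
c ·ₚ p = map (c ℤ.*_) p

_*ₚ_ : Poly → Poly → Poly
[]      *ₚ q = []
(a ∷ p) *ₚ q = (a ·ₚ q) +ₚ (+ 0 ∷ (p *ₚ q))

eval : Poly → ℤ → ℤ
eval []      x = + 0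
eval (a ∷ p) x = a ℤ.+ x ℤ.* eval p x

_^ₚ_ : Poly → ℕ → Poly
p ^ₚ zero  = + 1 ∷ []
p ^ₚ suc k = p *ₚ (p ^ₚ k)

X-_ : ℤ → Poly
X- λ₀ = (- λ₀) ∷ + 1 ∷ []

RootMult : Poly → ℤ → ℕ → Set
RootMult p λ₀ k = Σ Poly (λ q → (p ≈ₚ ((X- λ₀) ^ₚ k) *ₚ q) × ¬ (eval q λ₀ ≡ + 0))

sumₚ : ∀ {n} → (Fin n → Poly) → Poly
sumₚ {n} f = foldr _+ₚ_ [] (map f (allFin n))

sign : ℕ → ℤ
sign zero          = + 1
sign (suc zero)    = - (+ 1)
sign (suc (suc k)) = sign k

det : ∀ n → (Fin n → Fin n → Poly) → Poly
det zero    M = + 1 ∷ []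
det (suc n) M = sumₚ λ j →
  sign (toℕ j) ·ₚ (M fz j *ₚ det n (λ a b → M (fs a) (punchIn j b)))

Matrix : ℕ → Set
Matrix n = Fin n → Fin n → ℤ

charPoly : ∀ n → Matrix n → Poly
charPoly n A = det n λ a b →
  if does (a Fin.≟ b) then (- A a b) ∷ + 1 ∷ [] else (- A a b) ∷ []

EigMult : ∀ n → Matrix n → ℤ → ℕ → Set
EigMult n A λ₀ k = RootMult (charPoly n A) λ₀ k

-- The threshold graph NSG(m_1..m_h ; n_1..n_h), h = suc k, cells
-- indexed 0..k (cell i here is cell i+1 of the paper).
-- Vertices are listed cell by cell: U_i then V_i.

data Label (h : ℕ) : Set where
  uL : Fin h → Label h   -- vertex of the independent set, in U_i
  vL : Fin h → Label h   -- vertex of the clique, in V_i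

labels : ∀ h → (m n : Fin h → ℕ) → List (Label h)
labels h m n = concatMap (λ i → replicate (m i) (uL i) ++ replicate (n i) (vL i)) (allFin h)

-- adjacency between labels of distinct vertices
adjL : ∀ {h} → Label h → Label h → ℤ
adjL (vL i) (vL j) = + 1
adjL (uL i) (vL j) = if toℕ j ≤ᵇ toℕ i then + 1 else + 0
adjL (vL j) (uL i) = if toℕ j ≤ᵇ toℕ i then + 1 else + 0
adjL (uL i) (uL j) = + 0

nsgOrder : ∀ h → (m n : Fin h → ℕ) → ℕ
nsgOrder h m n = length (labels h m n)

nsgAdj : ∀ h → (m n : Fin h → ℕ) → Matrix (nsgOrder h m n)
nsgAdj h m n a b =
  if does (a Fin.≟ b) then + 0
  else adjL (lookup (labels h m n) a) (lookup (labels h m n) b)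

sumFin : ∀ {h} → (Fin h → ℕ) → ℕ
sumFin {h} f = sum (map f (allFin h))

-- Every cell U_i, V_i of NSG(m;n) is a block of twins: vertices with the same
-- neighbours outside the block, mutually non-adjacent in U_i and adjacent in V_i.
-- For two twins with mutual adjacency ε, subtracting one column of xI − A from the
-- other and expanding gives det(xI − A) = (x + ε) · det(xI − B), where B is the
-- weighted quotient in which the twins are merged into one vertex of weight w₁ + w₂.
-- Merging every block factors the characteristic polynomial as
-- x^(Σ(m_i − 1)) (x + 1)^(Σ(n_i − 1)) det(xI − B) with B indexed by u₁ v₁ … u_h v_h.
-- Eliminating the pairs (u_i, v_i) one at a time shows det(xI − B) is non-zero at 0,
-- and at −1 unless m_h = 1; in that case u_h and v_h are adjacent twins, one more
-- factor x + 1 splits off and the remaining quotient is again non-zero at −1.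

module Submission where

open import Defs
open import Data.Nat as ℕ using (ℕ; zero; suc; _<_; _≤_; z≤n; s≤s; _+_; _∸_; _≡ᵇ_)
import Data.Nat.Properties as ℕP
open import Data.Nat.ListAction using (sum)
open import Data.Integer as ℤ using (ℤ; +_; -_)
import Data.Integer.Properties as ℤP
open import Data.Integer.Tactic.RingSolver using () renaming (solve-∀ to solveℤ)
open import Data.Fin as Fin using (Fin; toℕ; punchIn; punchOut; fromℕ; inject₁) renaming (zero to fz; suc to fs)
open import Data.Fin.Properties using (punchIn-punchOut; punchInᵢ≢i; punchIn-injective; suc-injective; toℕ-injective; toℕ-fromℕ<; toℕ<n; toℕ-inject₁; toℕ-fromℕ)
open import Data.List using (List; []; _∷_; _++_; length; replicate; map; foldr; concatMap; tabulate; allFin; lookup)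
import Data.List.Properties as LP
open import Data.List.Relation.Unary.All as All using (All; []; _∷_)
import Data.List.Relation.Unary.All.Properties as AllP
open import Data.Maybe using (Maybe; nothing; just)
open import Data.Bool using (if_then_else_; true; false)
open import Data.Empty using (⊥-elim)
open import Data.Unit using (⊤; tt)
open import Data.Sum using (_⊎_; inj₁; inj₂)
open import Data.Product using (_×_; _,_; proj₁; proj₂)
open import Function using (_∘_; id)
open import Relation.Nullary using (¬_; yes; no; does)
open import Relation.Binary.Definitions using (tri<; tri≈; tri>)
open import Relation.Binary.PropositionalEquality
open import Algebra.Bundles using (CommutativeRing)
import Tactic.RingSolver as RS
import Tactic.RingSolver.Core.AlmostCommutativeRing as ACR
import Relation.Binary.Reasoning.Setoid as SetoidReasoning

-- Coefficientwise equality (as `_≈ₚ_`), wrapped in a record so that both polynomials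
-- can be recovered from a proof by unification.
infix 4 _≈_
record _≈_ (p q : Poly) : Set where
  constructor mk
  field at : ∀ i → coeff p i ≡ coeff q i
open _≈_ public

1ₚ ⟨0⟩ ⟨-1⟩ : Poly
1ₚ = + 1 ∷ []
⟨0⟩ = + 0 ∷ []
⟨-1⟩ = (- (+ 1)) ∷ []

-ₚ_ : Poly → Poly
-ₚ p = (- (+ 1)) ·ₚ p

≈refl : ∀ {p} → p ≈ p
≈refl = mk λ i → refl
≈sym : ∀ {p q} → p ≈ q → q ≈ p
≈sym e = mk λ i → sym (at e i)
≈trans : ∀ {p q r} → p ≈ q → q ≈ r → p ≈ r
≈trans e f = mk λ i → trans (at e i) (at f i)

≡⇒≈ : ∀ {p q} → p ≡ q → p ≈ q
≡⇒≈ refl = ≈refl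

coeff-+ : ∀ p q i → coeff (p +ₚ q) i ≡ coeff p i ℤ.+ coeff q i
coeff-+ [] q i = sym (ℤP.+-identityˡ _)
coeff-+ (a ∷ p) [] i = sym (ℤP.+-identityʳ _)
coeff-+ (a ∷ p) (b ∷ q) zero = refl
coeff-+ (a ∷ p) (b ∷ q) (suc i) = coeff-+ p q i

coeff-· : ∀ c p i → coeff (c ·ₚ p) i ≡ c ℤ.* coeff p i
coeff-· c [] i = sym (ℤP.*-zeroʳ c)
coeff-· c (a ∷ p) zero = refl
coeff-· c (a ∷ p) (suc i) = coeff-· c p i

∷-cong : ∀ {a b p q} → a ≡ b → p ≈ q → (a ∷ p) ≈ (b ∷ q)
∷-cong e f = mk λ { zero → e ; (suc i) → at f i }

∷-injectiveʳ : ∀ {a b p q} → (a ∷ p) ≈ (b ∷ q) → p ≈ q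
∷-injectiveʳ e = mk λ i → at e (suc i)

∷≈[]⇒≈[] : ∀ {a p} → (a ∷ p) ≈ [] → p ≈ []
∷≈[]⇒≈[] e = mk λ i → at e (suc i)

+-cong : ∀ {p p' q q'} → p ≈ p' → q ≈ q' → p +ₚ q ≈ p' +ₚ q'
+-cong {p} {p'} {q} {q'} e f = mk λ i →
  trans (coeff-+ p q i) (trans (cong₂ ℤ._+_ (at e i) (at f i)) (sym (coeff-+ p' q' i)))

+-comm : ∀ p q → p +ₚ q ≈ q +ₚ p
+-comm p q = mk λ i → trans (coeff-+ p q i) (trans (ℤP.+-comm (coeff p i) _) (sym (coeff-+ q p i)))

+-assoc : ∀ p q r → (p +ₚ q) +ₚ r ≈ p +ₚ (q +ₚ r)
+-assoc p q r = mk λ i → trans (coeff-+ (p +ₚ q) r i) (trans (cong (ℤ._+ coeff r i) (coeff-+ p q i))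
  (trans (ℤP.+-assoc (coeff p i) _ _) (trans (cong (λ z → coeff p i ℤ.+ z) (sym (coeff-+ q r i))) (sym (coeff-+ p (q +ₚ r) i)))))

+-identityˡ : ∀ p → [] +ₚ p ≈ p
+-identityˡ p = ≈refl
+-identityʳ : ∀ p → p +ₚ [] ≈ p
+-identityʳ [] = ≈refl
+-identityʳ (a ∷ p) = ≈refl

·-cong : ∀ c {p q} → p ≈ q → c ·ₚ p ≈ c ·ₚ q
·-cong c {p} {q} e = mk λ i → trans (coeff-· c p i) (trans (cong (c ℤ.*_) (at e i)) (sym (coeff-· c q i)))

·-congˡ : ∀ {c d} p → c ≡ d → c ·ₚ p ≈ d ·ₚ p
·-congˡ p refl = ≈refl

-‿inverseˡ : ∀ p → (-ₚ p) +ₚ p ≈ []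
-‿inverseˡ p = mk λ i → trans (coeff-+ (-ₚ p) p i) (trans (cong (ℤ._+ coeff p i) (coeff-· (- (+ 1)) p i))
  (trans (cong (ℤ._+ coeff p i) (ℤP.-1*i≡-i (coeff p i))) (ℤP.+-inverseˡ (coeff p i))))

≈[]⇒*≈[] : ∀ {p} q → p ≈ [] → p *ₚ q ≈ []
≈[]⇒*≈[] {[]} q e = ≈refl
≈[]⇒*≈[] {a ∷ p} q e = ≈trans (+-cong {a ·ₚ q} {[]} {+ 0 ∷ (p *ₚ q)} {+ 0 ∷ []} h1 (∷-cong refl (≈[]⇒*≈[] {p} q (∷≈[]⇒≈[] e)))) (mk λ { zero → refl ; (suc i) → refl })
  where
  h1 : a ·ₚ q ≈ []
  h1 = mk λ i → trans (coeff-· a q i) (trans (cong (ℤ._* coeff q i) (at e zero)) (ℤP.*-zeroˡ (coeff q i)))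

*-congˡ : ∀ {p p'} q → p ≈ p' → p *ₚ q ≈ p' *ₚ q
*-congˡ {[]} {p'} q e = ≈sym (≈[]⇒*≈[] q (≈sym e))
*-congˡ {a ∷ p} {[]} q e = ≈[]⇒*≈[] q e
*-congˡ {a ∷ p} {b ∷ p'} q e =
  +-cong (·-congˡ q (at e zero)) (∷-cong refl (*-congˡ q (∷-injectiveʳ e)))

*-congʳ : ∀ p {q q'} → q ≈ q' → p *ₚ q ≈ p *ₚ q'
*-congʳ [] e = ≈refl
*-congʳ (a ∷ p) e = +-cong (·-cong a e) (∷-cong refl (*-congʳ p e))

*-cong : ∀ {p p' q q'} → p ≈ p' → q ≈ q' → p *ₚ q ≈ p' *ₚ q'
*-cong {p} {p'} {q} {q'} e f = ≈trans (*-congˡ q e) (*-congʳ p' f)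

coeffShift : Poly → ℕ → ℤ
coeffShift r zero = + 0
coeffShift r (suc j) = coeff r j

coeff-*-∷ : ∀ a q r i → coeff ((a ·ₚ q) +ₚ (+ 0 ∷ r)) i ≡ a ℤ.* coeff q i ℤ.+ coeffShift r i
coeff-*-∷ a q r zero = trans (coeff-+ (a ·ₚ q) (+ 0 ∷ r) zero) (cong (ℤ._+ + 0) (coeff-· a q zero))
coeff-*-∷ a q r (suc i) = trans (coeff-+ (a ·ₚ q) (+ 0 ∷ r) (suc i)) (cong (ℤ._+ coeff r i) (coeff-· a q (suc i)))

coeffShift-cong : ∀ {r r'} → r ≈ r' → ∀ i → coeffShift r i ≡ coeffShift r' i
coeffShift-cong e zero = refl
coeffShift-cong e (suc i) = at e i

coeffShift-+ : ∀ r r' i → coeffShift (r +ₚ r') i ≡ coeffShift r i ℤ.+ coeffShift r' i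
coeffShift-+ r r' zero = refl
coeffShift-+ r r' (suc i) = coeff-+ r r' i

coeffShift-· : ∀ c r i → coeffShift (c ·ₚ r) i ≡ c ℤ.* coeffShift r i
coeffShift-· c r zero = sym (ℤP.*-zeroʳ c)
coeffShift-· c r (suc i) = coeff-· c r i

*-distribʳ : ∀ p p' q → (p +ₚ p') *ₚ q ≈ (p *ₚ q) +ₚ (p' *ₚ q)
*-distribʳ [] p' q = ≈refl
*-distribʳ (a ∷ p) [] q = ≈sym (+-identityʳ _)
*-distribʳ (a ∷ p) (b ∷ p') q = mk λ i →
  trans (coeff-*-∷ (a ℤ.+ b) q ((p +ₚ p') *ₚ q) i)
  (trans (cong (λ z → (a ℤ.+ b) ℤ.* coeff q i ℤ.+ z) (trans (coeffShift-cong (*-distribʳ p p' q) i) (coeffShift-+ (p *ₚ q) (p' *ₚ q) i)))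
  (trans (distrib-step a b (coeff q i) _ _)
  (sym (trans (coeff-+ ((a ∷ p) *ₚ q) ((b ∷ p') *ₚ q) i) (cong₂ ℤ._+_ (coeff-*-∷ a q (p *ₚ q) i) (coeff-*-∷ b q (p' *ₚ q) i))))))
  where
  distrib-step : ∀ (a b q x y : ℤ) → (a ℤ.+ b) ℤ.* q ℤ.+ (x ℤ.+ y) ≡ (a ℤ.* q ℤ.+ x) ℤ.+ (b ℤ.* q ℤ.+ y)
  distrib-step = solveℤ

*-distribˡ : ∀ p q q' → p *ₚ (q +ₚ q') ≈ (p *ₚ q) +ₚ (p *ₚ q')
*-distribˡ [] q q' = ≈refl
*-distribˡ (a ∷ p) q q' = mk λ i →
  trans (coeff-*-∷ a (q +ₚ q') (p *ₚ (q +ₚ q')) i)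
  (trans (cong₂ ℤ._+_ (cong (a ℤ.*_) (coeff-+ q q' i)) (trans (coeffShift-cong (*-distribˡ p q q') i) (coeffShift-+ (p *ₚ q) (p *ₚ q') i)))
  (trans (distrib-step' a (coeff q i) (coeff q' i) _ _)
  (sym (trans (coeff-+ ((a ∷ p) *ₚ q) ((a ∷ p) *ₚ q') i) (cong₂ ℤ._+_ (coeff-*-∷ a q (p *ₚ q) i) (coeff-*-∷ a q' (p *ₚ q') i))))))
  where
  distrib-step' : ∀ (a q q' x y : ℤ) → a ℤ.* (q ℤ.+ q') ℤ.+ (x ℤ.+ y) ≡ (a ℤ.* q ℤ.+ x) ℤ.+ (a ℤ.* q' ℤ.+ y)
  distrib-step' = solveℤ

·-*ˡ : ∀ c p q → (c ·ₚ p) *ₚ q ≈ c ·ₚ (p *ₚ q)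
·-*ˡ c [] q = ≈refl
·-*ˡ c (a ∷ p) q = mk λ i →
  trans (coeff-*-∷ (c ℤ.* a) q ((c ·ₚ p) *ₚ q) i)
  (trans (cong (λ z → (c ℤ.* a) ℤ.* coeff q i ℤ.+ z) (trans (coeffShift-cong (·-*ˡ c p q) i) (coeffShift-· c (p *ₚ q) i)))
  (trans (scale-step c a (coeff q i) _)
  (sym (trans (coeff-· c ((a ∷ p) *ₚ q) i) (cong (c ℤ.*_) (coeff-*-∷ a q (p *ₚ q) i))))))
  where
  scale-step : ∀ (c a q x : ℤ) → (c ℤ.* a) ℤ.* q ℤ.+ c ℤ.* x ≡ c ℤ.* (a ℤ.* q ℤ.+ x)
  scale-step = solveℤ

*-shiftʳ : ∀ p q → p *ₚ (+ 0 ∷ q) ≈ + 0 ∷ (p *ₚ q)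
*-shiftʳ [] q = mk λ { zero → refl ; (suc i) → refl }
*-shiftʳ (a ∷ p) q = mk λ
  { zero → trans (ℤP.+-identityʳ _) (ℤP.*-zeroʳ a)
  ; (suc i) → trans (coeff-+ (a ·ₚ q) (p *ₚ (+ 0 ∷ q)) i)
      (trans (cong (λ z → coeff (a ·ₚ q) i ℤ.+ z) (at (*-shiftʳ p q) i)) (sym (coeff-+ (a ·ₚ q) (+ 0 ∷ (p *ₚ q)) i))) }

*-constʳ : ∀ p a → p *ₚ (a ∷ []) ≈ a ·ₚ p
*-constʳ [] a = ≈refl
*-constʳ (b ∷ p) a = mk λ
  { zero → trans (ℤP.+-identityʳ _) (ℤP.*-comm b a)
  ; (suc i) → at (*-constʳ p a) i }

·-zeroˡ : ∀ p → + 0 ·ₚ p ≈ []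
·-zeroˡ p = mk λ i → trans (coeff-· (+ 0) p i) (ℤP.*-zeroˡ (coeff p i))

·-identityˡ : ∀ p → + 1 ·ₚ p ≈ p
·-identityˡ p = mk λ i → trans (coeff-· (+ 1) p i) (ℤP.*-identityˡ (coeff p i))

*-consʳ : ∀ q a p → q *ₚ (a ∷ p) ≈ (a ·ₚ q) +ₚ (+ 0 ∷ (q *ₚ p))
*-consʳ q a p = ≈trans (*-congʳ q h) (≈trans (*-distribˡ q (a ∷ []) (+ 0 ∷ p)) (+-cong (*-constʳ q a) (*-shiftʳ q p)))
  where
  h : (a ∷ p) ≈ ((a ∷ []) +ₚ (+ 0 ∷ p))
  h = mk λ { zero → sym (ℤP.+-identityʳ a) ; (suc i) → refl }

*-zeroʳ : ∀ q → q *ₚ [] ≈ []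
*-zeroʳ [] = ≈refl
*-zeroʳ (b ∷ q) = ≈trans (+-cong {b ·ₚ []} {[]} ≈refl (∷-cong refl (*-zeroʳ q))) (mk λ { zero → refl ; (suc i) → refl })

*-comm : ∀ p q → p *ₚ q ≈ q *ₚ p
*-comm [] q = ≈sym (*-zeroʳ q)
*-comm (a ∷ p) q = ≈trans (+-cong {a ·ₚ q} ≈refl (∷-cong refl (*-comm p q))) (≈sym (*-consʳ q a p))

*-assoc : ∀ p q r → (p *ₚ q) *ₚ r ≈ p *ₚ (q *ₚ r)
*-assoc [] q r = ≈refl
*-assoc (a ∷ p) q r =
  ≈trans (*-distribʳ (a ·ₚ q) (+ 0 ∷ (p *ₚ q)) r)
  (+-cong (·-*ˡ a q r) (≈trans (+-cong (·-zeroˡ r) ≈refl) (∷-cong refl (*-assoc p q r))))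

*-identityˡ : ∀ p → 1ₚ *ₚ p ≈ p
*-identityˡ p = ≈trans (+-cong {+ 1 ·ₚ p} {p} {+ 0 ∷ []} {[]} (·-identityˡ p) (mk λ { zero → refl ; (suc i) → refl })) (+-identityʳ p)

*-identityʳ : ∀ p → p *ₚ 1ₚ ≈ p
*-identityʳ p = ≈trans (*-comm p 1ₚ) (*-identityˡ p)

-‿cong : ∀ {p q} → p ≈ q → -ₚ p ≈ -ₚ q
-‿cong = ·-cong (- (+ 1))

poly-commutativeRing : CommutativeRing _ _
poly-commutativeRing = record
  { Carrier = Poly ; _≈_ = _≈_ ; _+_ = _+ₚ_ ; _*_ = _*ₚ_ ; -_ = -ₚ_ ; 0# = [] ; 1# = 1ₚ
  ; isCommutativeRing = record
    { isRing = record
      { +-isAbelianGroup = record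
        { isGroup = record
          { isMonoid = record
            { isSemigroup = record
              { isMagma = record { isEquivalence = record { refl = ≈refl ; sym = ≈sym ; trans = ≈trans } ; ∙-cong = +-cong }
              ; assoc = +-assoc }
            ; identity = +-identityˡ , +-identityʳ }
          ; inverse = -‿inverseˡ , (λ p → ≈trans (+-comm p (-ₚ p)) (-‿inverseˡ p))
          ; ⁻¹-cong = -‿cong }
        ; comm = +-comm }
      ; *-cong = *-cong
      ; *-assoc = *-assoc
      ; *-identity = *-identityˡ , *-identityʳ
      ; distrib = *-distribˡ , (λ x y z → *-distribʳ y z x) }
    ; *-comm = *-comm } }

+-congʳ : ∀ p {q q'} → q ≈ q' → p +ₚ q ≈ p +ₚ q'
+-congʳ p e = +-cong (≈refl {p}) e
+-congˡ : ∀ q {p p'} → p ≈ p' → p +ₚ q ≈ p' +ₚ q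
+-congˡ q e = +-cong e (≈refl {q})

open SetoidReasoning (CommutativeRing.setoid poly-commutativeRing)

poly-almostCommutativeRing : ACR.AlmostCommutativeRing _ _
poly-almostCommutativeRing = ACR.fromCommutativeRing poly-commutativeRing zt
  where
  zt : ∀ x → Maybe ([] ≈ x)
  zt [] = just ≈refl
  zt (_ ∷ _) = nothing

·-*ʳ : ∀ c p q → p *ₚ (c ·ₚ q) ≈ c ·ₚ (p *ₚ q)
·-*ʳ c p q = ≈trans (*-comm p (c ·ₚ q)) (≈trans (·-*ˡ c q p) (·-cong c (*-comm q p)))

·-· : ∀ a b p → a ·ₚ (b ·ₚ p) ≈ (a ℤ.* b) ·ₚ p
·-· a b p = mk λ i → trans (coeff-· a (b ·ₚ p) i) (trans (cong (a ℤ.*_) (coeff-· b p i))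
  (trans (sym (ℤP.*-assoc a b (coeff p i))) (sym (coeff-· (a ℤ.* b) p i))))

·-distrib-+ : ∀ a p q → a ·ₚ (p +ₚ q) ≈ a ·ₚ p +ₚ a ·ₚ q
·-distrib-+ a p q = mk λ i → trans (coeff-· a (p +ₚ q) i) (trans (cong (a ℤ.*_) (coeff-+ p q i))
  (trans (ℤP.*-distribˡ-+ a (coeff p i) _) (sym (trans (coeff-+ (a ·ₚ p) (a ·ₚ q) i) (cong₂ ℤ._+_ (coeff-· a p i) (coeff-· a q i))))))

·-*-·-exchange : ∀ a b c d x y D → a ℤ.* b ≡ c ℤ.* d → a ·ₚ (x *ₚ (b ·ₚ (y *ₚ D))) ≈ c ·ₚ (y *ₚ (d ·ₚ (x *ₚ D)))
·-*-·-exchange a b c d x y D e = begin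
  a ·ₚ (x *ₚ (b ·ₚ (y *ₚ D))) ≈⟨ ·-cong a (·-*ʳ b x (y *ₚ D)) ⟩
  a ·ₚ (b ·ₚ (x *ₚ (y *ₚ D))) ≈⟨ ·-· a b (x *ₚ (y *ₚ D)) ⟩
  (a ℤ.* b) ·ₚ (x *ₚ (y *ₚ D)) ≈⟨ ≡⇒≈ (cong (_·ₚ (x *ₚ (y *ₚ D))) e) ⟩
  (c ℤ.* d) ·ₚ (x *ₚ (y *ₚ D)) ≈⟨ ·-cong (c ℤ.* d) (≈trans (≈sym (*-assoc x y D)) (≈trans (*-congˡ D (*-comm x y)) (*-assoc y x D))) ⟩
  (c ℤ.* d) ·ₚ (y *ₚ (x *ₚ D)) ≈⟨ ≈sym (·-· c d (y *ₚ (x *ₚ D))) ⟩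
  c ·ₚ (d ·ₚ (y *ₚ (x *ₚ D))) ≈⟨ ·-cong c (≈sym (·-*ʳ d y (x *ₚ D))) ⟩
  c ·ₚ (y *ₚ (d ·ₚ (x *ₚ D))) ∎

·≈const* : ∀ c p → c ·ₚ p ≈ (c ∷ []) *ₚ p
·≈const* c p = ≈sym (≈trans (*-comm (c ∷ []) p) (*-constʳ p c))

const-cong : ∀ {a b} → a ≡ b → (a ∷ []) ≈ (b ∷ [])
const-cong refl = ≈refl

const≈[] : ∀ {v} → v ≡ + 0 → (v ∷ []) ≈ []
const≈[] refl = mk λ { zero → refl ; (suc i) → refl }

^ₚ-+ : ∀ p a b → p ^ₚ (a ℕ.+ b) ≈ (p ^ₚ a) *ₚ (p ^ₚ b)
^ₚ-+ p zero b = ≈sym (*-identityˡ _)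
^ₚ-+ p (suc a) b = ≈trans (*-congʳ p (^ₚ-+ p a b)) (≈sym (*-assoc p (p ^ₚ a) (p ^ₚ b)))

Xₚ : Poly
Xₚ = + 0 ∷ + 1 ∷ []

X+1ₚ : Poly
X+1ₚ = Xₚ +ₚ (+ 1 ∷ [])

eval-+ : ∀ p q x → eval (p +ₚ q) x ≡ eval p x ℤ.+ eval q x
eval-+ [] q x = sym (ℤP.+-identityˡ _)
eval-+ (a ∷ p) [] x = sym (ℤP.+-identityʳ _)
eval-+ (a ∷ p) (b ∷ q) x = trans (cong (λ z → a ℤ.+ b ℤ.+ x ℤ.* z) (eval-+ p q x)) (arith a b x (eval p x) (eval q x))
  where
  arith : ∀ a b x u v → a ℤ.+ b ℤ.+ x ℤ.* (u ℤ.+ v) ≡ a ℤ.+ x ℤ.* u ℤ.+ (b ℤ.+ x ℤ.* v)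
  arith = solveℤ

eval-· : ∀ c p x → eval (c ·ₚ p) x ≡ c ℤ.* eval p x
eval-· c [] x = sym (ℤP.*-zeroʳ c)
eval-· c (a ∷ p) x = trans (cong (λ z → c ℤ.* a ℤ.+ x ℤ.* z) (eval-· c p x)) (arith c a x (eval p x))
  where
  arith : ∀ c a x u → c ℤ.* a ℤ.+ x ℤ.* (c ℤ.* u) ≡ c ℤ.* (a ℤ.+ x ℤ.* u)
  arith = solveℤ

eval-* : ∀ p q x → eval (p *ₚ q) x ≡ eval p x ℤ.* eval q x
eval-* [] q x = refl
eval-* (a ∷ p) q x = trans (eval-+ (a ·ₚ q) (+ 0 ∷ (p *ₚ q)) x)
  (trans (cong₂ (λ u v → u ℤ.+ (+ 0 ℤ.+ x ℤ.* v)) (eval-· a q x) (eval-* p q x)) (arith a x (eval p x) (eval q x)))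
  where
  arith : ∀ a x u v → a ℤ.* v ℤ.+ (+ 0 ℤ.+ x ℤ.* (u ℤ.* v)) ≡ (a ℤ.+ x ℤ.* u) ℤ.* v
  arith = solveℤ

eval-0 : ∀ {p} x → p ≈ [] → eval p x ≡ + 0
eval-0 {[]} x e = refl
eval-0 {a ∷ p} x e = trans (cong₂ (λ u v → u ℤ.+ x ℤ.* v) (at e zero) (eval-0 x (∷≈[]⇒≈[] e))) (cong (λ z → + 0 ℤ.+ z) (ℤP.*-zeroʳ x))

eval-≈ : ∀ {p q} x → p ≈ q → eval p x ≡ eval q x
eval-≈ {[]} {q} x e = sym (eval-0 x (≈sym e))
eval-≈ {a ∷ p} {[]} x e = eval-0 x e
eval-≈ {a ∷ p} {b ∷ q} x e = cong₂ (λ u v → u ℤ.+ x ℤ.* v) (at e zero) (eval-≈ x (∷-injectiveʳ e))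

record NonRootAt (x : ℤ) (p : Poly) : Set where
  constructor nonRoot
  field eval≢0 : ¬ (eval p x ≡ + 0)
open NonRootAt public

*-≢0 : ∀ {a b : ℤ} → ¬ (a ≡ + 0) → ¬ (b ≡ + 0) → ¬ (a ℤ.* b ≡ + 0)
*-≢0 {a} a≢0 b≢0 e with ℤP.i*j≡0⇒i≡0∨j≡0 a e
... | inj₁ x = a≢0 x
... | inj₂ x = b≢0 x

-*1≢0 : ∀ {a} → ¬ (a ≡ + 0) → ¬ (- (a ℤ.* + 1) ≡ + 0)
-*1≢0 {a} a≢0 e = a≢0 (trans (sym (ℤP.*-identityʳ a)) (trans (sym (ℤP.neg-involutive _)) (cong -_ e)))

-*-zeroʳ : ∀ w A → A ≡ + 0 → - (w ℤ.* A) ≡ + 0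
-*-zeroʳ w _ refl = cong -_ (ℤP.*-zeroʳ w)

≢1⇒-1+≢0 : ∀ {a} → ¬ (a ≡ + 1) → ¬ (a ℤ.+ (- (+ 1)) ≡ + 0)
≢1⇒-1+≢0 {a} a≢1 e = a≢1 (trans (sym (arith a)) (cong (λ z → z ℤ.+ + 1) e))
  where
  arith : ∀ a → a ℤ.+ (- (+ 1)) ℤ.+ + 1 ≡ a
  arith = solveℤ

-0-1≢0 : ¬ ((- (+ 0)) ℤ.+ (- (+ 1)) ≡ + 0)
-0-1≢0 ()

NonRootAt-* : ∀ {x p q} → NonRootAt x p → NonRootAt x q → NonRootAt x (p *ₚ q)
NonRootAt-* {x} {p} {q} np nq = nonRoot λ e → *-≢0 (eval≢0 np) (eval≢0 nq) (trans (sym (eval-* p q x)) e)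

NonRootAt-· : ∀ {x c p} → ¬ (c ≡ + 0) → NonRootAt x p → NonRootAt x (c ·ₚ p)
NonRootAt-· {x} {c} {p} nc np = nonRoot λ e → *-≢0 nc (eval≢0 np) (trans (sym (eval-· c p x)) e)

NonRootAt-≈ : ∀ {x p q} → p ≈ q → NonRootAt x q → NonRootAt x p
NonRootAt-≈ {x} e nq = nonRoot λ f → eval≢0 nq (trans (sym (eval-≈ x e)) f)

NonRootAt-const : ∀ {x} v → ¬ (v ≡ + 0) → NonRootAt x (v ∷ [])
NonRootAt-const {x} v nv = nonRoot λ e → nv (trans (sym (trans (cong (λ z → v ℤ.+ z) (ℤP.*-zeroʳ x)) (ℤP.+-identityʳ v))) e)

NonRootAt-1 : ∀ {x} → NonRootAt x 1ₚ
NonRootAt-1 = NonRootAt-const (+ 1) (λ ())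

NonRootAt-^ : ∀ {x p} k → NonRootAt x p → NonRootAt x (p ^ₚ k)
NonRootAt-^ zero np = NonRootAt-1
NonRootAt-^ (suc k) np = NonRootAt-* np (NonRootAt-^ k np)

Σₚ : ∀ {n} → (Fin n → Poly) → Poly
Σₚ {zero} f = []
Σₚ {suc n} f = f fz +ₚ Σₚ (λ j → f (fs j))

foldr-tabulate : ∀ {n} (f : Fin n → Poly) → foldr _+ₚ_ [] (tabulate f) ≡ Σₚ f
foldr-tabulate {zero} f = refl
foldr-tabulate {suc n} f = cong (f fz +ₚ_) (foldr-tabulate (f ∘ fs))

sumₚ≡Σₚ : ∀ {n} (f : Fin n → Poly) → sumₚ f ≡ Σₚ f
sumₚ≡Σₚ {n} f = trans (cong (foldr _+ₚ_ []) (LP.map-tabulate id f)) (foldr-tabulate f)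

Σₚ-cong : ∀ {n} {f g : Fin n → Poly} → (∀ j → f j ≈ g j) → Σₚ f ≈ Σₚ g
Σₚ-cong {zero} e = ≈refl
Σₚ-cong {suc n} e = +-cong (e fz) (Σₚ-cong (e ∘ fs))

Σₚ-linear : ∀ {n} (r s : Poly) (f g : Fin n → Poly) → Σₚ (λ j → r *ₚ f j +ₚ s *ₚ g j) ≈ r *ₚ Σₚ f +ₚ s *ₚ Σₚ g
Σₚ-linear {zero} r s f g = ≈sym (+-cong (*-zeroʳ r) (*-zeroʳ s))
Σₚ-linear {suc n} r s f g = begin
  (r *ₚ f fz +ₚ s *ₚ g fz) +ₚ Σₚ (λ j → r *ₚ f (fs j) +ₚ s *ₚ g (fs j))
    ≈⟨ +-congʳ (r *ₚ f fz +ₚ s *ₚ g fz) (Σₚ-linear r s (f ∘ fs) (g ∘ fs)) ⟩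
  (r *ₚ f fz +ₚ s *ₚ g fz) +ₚ (r *ₚ Σₚ (f ∘ fs) +ₚ s *ₚ Σₚ (g ∘ fs))
    ≈⟨ interchange r s (f fz) (g fz) (Σₚ (f ∘ fs)) (Σₚ (g ∘ fs)) ⟩
  r *ₚ (f fz +ₚ Σₚ (f ∘ fs)) +ₚ s *ₚ (g fz +ₚ Σₚ (g ∘ fs)) ∎
  where
  interchange : ∀ r s a b x y → (r *ₚ a +ₚ s *ₚ b) +ₚ (r *ₚ x +ₚ s *ₚ y) ≈ r *ₚ (a +ₚ x) +ₚ s *ₚ (b +ₚ y)
  interchange = RS.solve-∀ poly-almostCommutativeRing

Σₚ-zero : ∀ {n} {f : Fin n → Poly} → (∀ j → f j ≈ []) → Σₚ f ≈ []
Σₚ-zero {zero} e = ≈refl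
Σₚ-zero {suc n} e = +-cong (e fz) (Σₚ-zero (e ∘ fs))

Σₚ-punchIn : ∀ {n} (f : Fin (suc n) → Poly) (c : Fin (suc n)) → Σₚ f ≈ f c +ₚ Σₚ (λ j → f (punchIn c j))
Σₚ-punchIn f fz = ≈refl
Σₚ-punchIn {suc n} f (fs c) = begin
  f fz +ₚ Σₚ (f ∘ fs) ≈⟨ +-congʳ (f fz) (Σₚ-punchIn (f ∘ fs) c) ⟩
  f fz +ₚ (f (fs c) +ₚ Σₚ (λ j → f (fs (punchIn c j))))
    ≈⟨ +-leftComm (f fz) (f (fs c)) (Σₚ (λ j → f (fs (punchIn c j)))) ⟩
  f (fs c) +ₚ (f fz +ₚ Σₚ (λ j → f (fs (punchIn c j)))) ∎
  where
  +-leftComm : ∀ a b c → a +ₚ (b +ₚ c) ≈ b +ₚ (a +ₚ c)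
  +-leftComm = RS.solve-∀ poly-almostCommutativeRing

Σₚ-single : ∀ {n} (f : Fin (suc n) → Poly) (c : Fin (suc n)) → (∀ j → j ≢ c → f j ≈ []) → Σₚ f ≈ f c
Σₚ-single f c e = ≈trans (Σₚ-punchIn f c) (≈trans (+-congʳ (f c) (Σₚ-zero (λ j → e (punchIn c j) (punchInᵢ≢i c j)))) (+-identityʳ _))

Σₚ-pair : ∀ {n} (f : Fin (suc n) → Poly) (c d : Fin (suc n)) → c ≢ d → (∀ j → j ≢ c → j ≢ d → f j ≈ []) → Σₚ f ≈ f c +ₚ f d
Σₚ-pair {zero} f fz fz c≢d e = ⊥-elim (c≢d refl)
Σₚ-pair {suc n} f c d c≢d e = ≈trans (Σₚ-punchIn f c) (+-congʳ (f c) (≈trans (Σₚ-single (f ∘ punchIn c) d' h) (≡⇒≈ (cong f (punchIn-punchOut c≢d)))))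
  where
  d' = punchOut c≢d
  h : ∀ j → j ≢ d' → f (punchIn c j) ≈ []
  h j j≢d' = e (punchIn c j) (punchInᵢ≢i c j) (λ eq → j≢d' (punchIn-injective c j d' (trans eq (sym (punchIn-punchOut c≢d)))))

Σₚ-scale : ∀ {n} k x (f : Fin n → Poly) → Σₚ (λ j → k ·ₚ (x *ₚ f j)) ≈ k ·ₚ (x *ₚ Σₚ f)
Σₚ-scale {zero} k x f = ≈sym (≈trans (·-cong k (*-zeroʳ x)) ≈refl)
Σₚ-scale {suc n} k x f = begin
  k ·ₚ (x *ₚ f fz) +ₚ Σₚ (λ j → k ·ₚ (x *ₚ f (fs j))) ≈⟨ +-congʳ (k ·ₚ (x *ₚ f fz)) (Σₚ-scale k x (f ∘ fs)) ⟩
  k ·ₚ (x *ₚ f fz) +ₚ k ·ₚ (x *ₚ Σₚ (f ∘ fs)) ≈⟨ ≈sym (·-distrib-+ k (x *ₚ f fz) (x *ₚ Σₚ (f ∘ fs))) ⟩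
  k ·ₚ (x *ₚ f fz +ₚ x *ₚ Σₚ (f ∘ fs)) ≈⟨ ·-cong k (≈sym (*-distribˡ x (f fz) (Σₚ (f ∘ fs)))) ⟩
  k ·ₚ (x *ₚ (f fz +ₚ Σₚ (f ∘ fs))) ∎

Σₚ-+ : ∀ {n} (f g : Fin n → Poly) → Σₚ (λ j → f j +ₚ g j) ≈ Σₚ f +ₚ Σₚ g
Σₚ-+ {zero} f g = ≈refl
Σₚ-+ {suc n} f g = ≈trans (+-congʳ (f fz +ₚ g fz) (Σₚ-+ (f ∘ fs) (g ∘ fs))) (interchange (f fz) (g fz) (Σₚ (f ∘ fs)) (Σₚ (g ∘ fs)))
  where
  interchange : ∀ a b c d → (a +ₚ b) +ₚ (c +ₚ d) ≈ (a +ₚ c) +ₚ (b +ₚ d)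
  interchange = RS.solve-∀ poly-almostCommutativeRing

eval-Σₚ : ∀ {n} (f g : Fin n → Poly) x → (∀ j → eval (f j) x ≡ eval (g j) x) → eval (Σₚ f) x ≡ eval (Σₚ g) x
eval-Σₚ {zero} f g x h = refl
eval-Σₚ {suc n} f g x h = trans (eval-+ (f fz) (Σₚ (f ∘ fs)) x) (trans (cong₂ ℤ._+_ (h fz) (eval-Σₚ (f ∘ fs) (g ∘ fs) x (h ∘ fs))) (sym (eval-+ (g fz) (Σₚ (g ∘ fs)) x)))

toℕ-punchIn : ∀ {n} (i : Fin (suc n)) (j : Fin n) →
  (toℕ j < toℕ i × toℕ (punchIn i j) ≡ toℕ j) ⊎ (toℕ i ≤ toℕ j × toℕ (punchIn i j) ≡ suc (toℕ j))
toℕ-punchIn fz j = inj₂ (z≤n , refl)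
toℕ-punchIn (fs i) fz = inj₁ (s≤s z≤n , refl)
toℕ-punchIn (fs i) (fs j) with toℕ-punchIn i j
... | inj₁ (lt , e) = inj₁ (s≤s lt , cong suc e)
... | inj₂ (le , e) = inj₂ (s≤s le , cong suc e)

toℕ-≢ : ∀ {n} {c d : Fin n} → toℕ c ≢ toℕ d → c ≢ d
toℕ-≢ ne refl = ne refl

punchIn-punchIn-comm : ∀ {m} (c : Fin (suc (suc m))) (j' c' : Fin (suc m)) → punchIn (punchIn c j') c' ≡ c
  → ∀ b → punchIn (punchIn c j') (punchIn c' b) ≡ punchIn c (punchIn j' b)
punchIn-punchIn-comm fz j' fz h b = refl
punchIn-punchIn-comm fz j' (fs c') () b
punchIn-punchIn-comm (fs c) fz c' h b rewrite suc-injective h = refl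
punchIn-punchIn-comm {suc m} (fs c) (fs j) fz () b
punchIn-punchIn-comm {suc m} (fs c) (fs j) (fs c') h fz = refl
punchIn-punchIn-comm {suc m} (fs c) (fs j) (fs c') h (fs b) = cong fs (punchIn-punchIn-comm c j c' (suc-injective h) b)

PunchedAt : ℕ → ℕ → ℕ → Set
PunchedAt q i i' = (i < q × i' ≡ i) ⊎ (q ≤ i × i' ≡ suc i)

PunchedAt-functional : ∀ {q i i' i''} → PunchedAt q i i' → PunchedAt q i i'' → i' ≡ i''
PunchedAt-functional (inj₁ (_ , e)) (inj₁ (_ , f)) = trans e (sym f)
PunchedAt-functional (inj₂ (_ , e)) (inj₂ (_ , f)) = trans e (sym f)
PunchedAt-functional (inj₁ (lt , _)) (inj₂ (ge , _)) = ⊥-elim (ℕP.<⇒≱ lt ge)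
PunchedAt-functional (inj₂ (ge , _)) (inj₁ (lt , _)) = ⊥-elim (ℕP.<⇒≱ lt ge)

PunchedAt-injective : ∀ {q i i' j j'} → PunchedAt q i i' → PunchedAt q j j' → i' ≡ j' → i ≡ j
PunchedAt-injective (inj₁ (_ , e)) (inj₁ (_ , f)) g = trans (sym e) (trans g f)
PunchedAt-injective (inj₂ (_ , e)) (inj₂ (_ , f)) g = ℕP.suc-injective (trans (sym e) (trans g f))
PunchedAt-injective {q} {i} {i'} {j} {j'} (inj₁ (lt , e)) (inj₂ (ge , f)) g = ⊥-elim (ℕP.<-asym lt (ℕP.≤-<-trans ge (ℕP.≤-reflexive x)))
  where
  x : suc j ≡ i
  x = trans (sym f) (trans (sym g) e)
PunchedAt-injective {q} {i} {i'} {j} {j'} (inj₂ (ge , e)) (inj₁ (lt , f)) g = ⊥-elim (ℕP.<-asym lt (ℕP.≤-<-trans ge (ℕP.≤-reflexive x)))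
  where
  x : suc i ≡ j
  x = trans (sym e) (trans g f)

PunchedAt-punchIn : ∀ {n} (p : Fin (suc n)) (a : Fin n) → PunchedAt (toℕ p) (toℕ a) (toℕ (punchIn p a))
PunchedAt-punchIn p a with toℕ-punchIn p a
... | inj₁ (lt , e) = inj₁ (lt , e)
... | inj₂ (ge , e) = inj₂ (ge , e)

PunchedAt-punchIn-pred : ∀ {n} (p : Fin (suc n)) (a : Fin n) q → toℕ p ≡ suc q → toℕ a ≢ q → PunchedAt q (toℕ a) (toℕ (punchIn p a))
PunchedAt-punchIn-pred p a q e ne with toℕ-punchIn p a
... | inj₁ (lt , f) = inj₁ (ℕP.≤∧≢⇒< (ℕP.≤-pred (subst (suc (toℕ a) ≤_) e lt)) ne , f)
... | inj₂ (ge , f) = inj₂ (ℕP.≤-trans (ℕP.n≤1+n _) (subst (_≤ toℕ a) e ge) , f)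

≤⇒≤ᵇ≡true : ∀ {m n} → m ≤ n → (m ℕ.≤ᵇ n) ≡ true
≤⇒≤ᵇ≡true z≤n = refl
≤⇒≤ᵇ≡true (s≤s {zero} le) = refl
≤⇒≤ᵇ≡true (s≤s {suc m} {suc n} le) = ≤⇒≤ᵇ≡true le

>⇒≤ᵇ≡false : ∀ {m n} → n < m → (m ℕ.≤ᵇ n) ≡ false
>⇒≤ᵇ≡false {suc m} {zero} _ = refl
>⇒≤ᵇ≡false {suc zero} {suc n} (s≤s ())
>⇒≤ᵇ≡false {suc (suc m)} {suc n} (s≤s lt) = >⇒≤ᵇ≡false {suc m} {n} lt

Increasing : ∀ {h} → List (Fin h) → Set
Increasing [] = ⊤
Increasing (x ∷ xs) = All (λ y → toℕ x < toℕ y) xs × Increasing xs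

Increasing-tabulate : ∀ {h n} (f : Fin n → Fin h) → (∀ a b → toℕ a < toℕ b → toℕ (f a) < toℕ (f b)) → Increasing (tabulate f)
Increasing-tabulate {n = zero} f mono = tt
Increasing-tabulate {n = suc n} f mono = AllP.tabulate⁺ (λ a → mono fz (fs a) (s≤s z≤n)) , Increasing-tabulate (f ∘ fs) (λ a b lt → mono (fs a) (fs b) (s≤s lt))

tabulate-snoc : ∀ {A : Set} k (f : Fin (suc k) → A) → tabulate f ≡ tabulate (f ∘ inject₁) ++ (f (fromℕ k) ∷ [])
tabulate-snoc zero f = refl
tabulate-snoc (suc k) f = cong (f fz ∷_) (tabulate-snoc k (f ∘ fs))

Last : ∀ {h} → (Fin h → Set) → List (Fin h) → Set
Last P [] = ⊤
Last P (x ∷ []) = P x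
Last P (x ∷ y ∷ ys) = Last P (y ∷ ys)

Last-tabulate : ∀ {h} k (P : Fin h → Set) (f : Fin (suc k) → Fin h) → P (f (fromℕ k)) → Last P (tabulate f)
Last-tabulate zero P f p = p
Last-tabulate (suc k) P f p = Last-tabulate k P (f ∘ fs) p

sign-suc : ∀ k → sign (suc k) ≡ - sign k
sign-suc zero = refl
sign-suc (suc zero) = refl
sign-suc (suc (suc k)) = sign-suc k

sign-+ : ∀ a b → sign (a + b) ≡ sign a ℤ.* sign b
sign-+ zero b = sym (ℤP.*-identityˡ (sign b))
sign-+ (suc a) b = trans (sign-suc (a + b)) (trans (cong -_ (sign-+ a b))
  (trans (ℤP.neg-distribˡ-* (sign a) (sign b)) (cong (ℤ._* sign b) (sym (sign-suc a)))))

sign-suc+ : ∀ {n} r (c : Fin n) → sign (suc (r + toℕ c)) ≡ - (sign r ℤ.* sign (toℕ c))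
sign-suc+ r c = trans (sign-suc (r + toℕ c)) (cong -_ (sign-+ r (toℕ c)))

sign-double : ∀ q → sign (q + q) ≡ + 1
sign-double zero = refl
sign-double (suc q) = trans (cong (λ z → sign (suc z)) (ℕP.+-suc q q)) (sign-double q)

sign≢0 : ∀ k → ¬ (sign k ≡ + 0)
sign≢0 zero ()
sign≢0 (suc zero) ()
sign≢0 (suc (suc k)) = sign≢0 k

sign-cancel : ∀ k p q → p ≈ q → sign k ·ₚ p +ₚ sign (suc k) ·ₚ q ≈ []
sign-cancel k p q e = mk λ i → trans (coeff-+ (sign k ·ₚ p) (sign (suc k) ·ₚ q) i)
  (trans (cong₂ ℤ._+_ (coeff-· (sign k) p i) (trans (coeff-· (sign (suc k)) q i) (cong₂ ℤ._*_ (sign-suc k) (sym (at e i)))))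
  (arith (sign k) (coeff p i)))
  where
  arith : ∀ a x → a ℤ.* x ℤ.+ (- a) ℤ.* x ≡ + 0
  arith = solveℤ

PolyMatrix : ℕ → Set
PolyMatrix n = Fin n → Fin n → Poly

minor : ∀ {n} → Fin (suc n) → Fin (suc n) → PolyMatrix (suc n) → PolyMatrix n
minor r c M a b = M (punchIn r a) (punchIn c b)

laplaceTerm : ∀ {n} → PolyMatrix (suc n) → Fin (suc n) → Poly
laplaceTerm {n} M j = sign (toℕ j) ·ₚ (M fz j *ₚ det n (minor fz j M))

det-laplace : ∀ {n} (M : PolyMatrix (suc n)) → det (suc n) M ≈ Σₚ (laplaceTerm M)
det-laplace M = ≡⇒≈ (sumₚ≡Σₚ (laplaceTerm M))

det-cong : ∀ n {M N : PolyMatrix n} → (∀ a b → M a b ≈ N a b) → det n M ≈ det n N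
det-cong zero e = ≈refl
det-cong (suc n) {M} {N} e = ≈trans (det-laplace M) (≈trans (Σₚ-cong {f = laplaceTerm M} {g = laplaceTerm N} (λ j → ·-cong (sign (toℕ j)) (*-cong
    (e fz j) (det-cong n (λ a b → e (fs a) (punchIn j b)))))) (≈sym (det-laplace N)))

eval-det : ∀ n (M M' : PolyMatrix n) x → (∀ a b → eval (M a b) x ≡ eval (M' a b) x) → eval (det n M) x ≡ eval (det n M') x
eval-det zero M M' x h = refl
eval-det (suc n) M M' x h = trans (eval-≈ x (det-laplace M)) (trans (eval-Σₚ (laplaceTerm M) (laplaceTerm M') x pt) (sym (eval-≈ x (det-laplace M'))))
  where
  pt : ∀ j → eval (laplaceTerm M j) x ≡ eval (laplaceTerm M' j) x
  pt j = trans (eval-· (sign (toℕ j)) (M fz j *ₚ det n (minor fz j M)) x) (trans (cong (sign (toℕ j) ℤ.*_) (trans (eval-* (M fz j) (det n (minor fz j M)) x)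
    (cong₂ ℤ._*_ (h fz j) (eval-det n (minor fz j M) (minor fz j M') x (λ a b → h (fs a) (punchIn j b))))))
    (sym (trans (eval-· (sign (toℕ j)) (M' fz j *ₚ det n (minor fz j M')) x) (cong (sign (toℕ j) ℤ.*_) (eval-* (M' fz j) (det n (minor fz j M')) x)))))

det-1 : ∀ (M : PolyMatrix 1) → det 1 M ≈ M fz fz
det-1 M = ≈trans (det-laplace M) (≈trans (+-identityʳ _) (≈trans (·-identityˡ _) (*-identityʳ (M fz fz))))

det-linearColumn : ∀ n (M N P : PolyMatrix n) (c : Fin n) (r s : Poly)
  → (∀ a → N a c ≈ r *ₚ M a c +ₚ s *ₚ P a c)
  → (∀ a b → b ≢ c → N a b ≈ M a b)
  → (∀ a b → b ≢ c → N a b ≈ P a b)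
  → det n N ≈ r *ₚ det n M +ₚ s *ₚ det n P
det-linearColumn (suc n) M N P c r s hc hM hP =
  ≈trans (det-laplace N) (≈trans (Σₚ-cong {f = laplaceTerm N} pt) (≈trans (Σₚ-linear r s (laplaceTerm M) (laplaceTerm P))
    (+-cong (*-congʳ r (≈sym (det-laplace M))) (*-congʳ s (≈sym (det-laplace P))))))
  where
  distribute-column : ∀ k r s a b D → k *ₚ ((r *ₚ a +ₚ s *ₚ b) *ₚ D) ≈ r *ₚ (k *ₚ (a *ₚ D)) +ₚ s *ₚ (k *ₚ (b *ₚ D))
  distribute-column = RS.solve-∀ poly-almostCommutativeRing
  distribute-minor : ∀ k r s e Dm Dp → k *ₚ (e *ₚ (r *ₚ Dm +ₚ s *ₚ Dp)) ≈ r *ₚ (k *ₚ (e *ₚ Dm)) +ₚ s *ₚ (k *ₚ (e *ₚ Dp))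
  distribute-minor = RS.solve-∀ poly-almostCommutativeRing
  pt : ∀ j → laplaceTerm N j ≈ r *ₚ laplaceTerm M j +ₚ s *ₚ laplaceTerm P j
  pt j with j Fin.≟ c
  ... | yes refl = begin
      sign (toℕ j) ·ₚ (N fz j *ₚ DN) ≈⟨ ·≈const* (sign (toℕ j)) _ ⟩
      k *ₚ (N fz j *ₚ DN) ≈⟨ *-congʳ k (*-congˡ DN (hc fz)) ⟩
      k *ₚ ((r *ₚ M fz j +ₚ s *ₚ P fz j) *ₚ DN) ≈⟨ distribute-column k r s (M fz j) (P fz j) DN ⟩
      r *ₚ (k *ₚ (M fz j *ₚ DN)) +ₚ s *ₚ (k *ₚ (P fz j *ₚ DN))
        ≈⟨ +-cong (*-congʳ r (*-congʳ k (*-congʳ (M fz j) eM))) (*-congʳ s (*-congʳ k (*-congʳ (P fz j) eP))) ⟩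
      r *ₚ (k *ₚ (M fz j *ₚ DM)) +ₚ s *ₚ (k *ₚ (P fz j *ₚ DP))
        ≈⟨ ≈sym (+-cong (*-congʳ r (·≈const* (sign (toℕ j)) _)) (*-congʳ s (·≈const* (sign (toℕ j)) _))) ⟩
      r *ₚ laplaceTerm M j +ₚ s *ₚ laplaceTerm P j ∎
    where
    k = sign (toℕ j) ∷ []
    DN = det n (minor fz j N)
    DM = det n (minor fz j M)
    DP = det n (minor fz j P)
    eM : DN ≈ DM
    eM = det-cong n (λ a b → hM (fs a) (punchIn j b) (punchInᵢ≢i j b))
    eP : DN ≈ DP
    eP = det-cong n (λ a b → hP (fs a) (punchIn j b) (punchInᵢ≢i j b))
  ... | no j≢c = begin
      sign (toℕ j) ·ₚ (N fz j *ₚ DN) ≈⟨ ·≈const* (sign (toℕ j)) _ ⟩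
      k *ₚ (N fz j *ₚ DN) ≈⟨ *-congʳ k (*-congʳ (N fz j) IH) ⟩
      k *ₚ (N fz j *ₚ (r *ₚ DM +ₚ s *ₚ DP)) ≈⟨ distribute-minor k r s (N fz j) DM DP ⟩
      r *ₚ (k *ₚ (N fz j *ₚ DM)) +ₚ s *ₚ (k *ₚ (N fz j *ₚ DP))
        ≈⟨ +-cong (*-congʳ r (*-congʳ k (*-congˡ DM (hM fz j j≢c)))) (*-congʳ s (*-congʳ k (*-congˡ DP (hP fz j j≢c)))) ⟩
      r *ₚ (k *ₚ (M fz j *ₚ DM)) +ₚ s *ₚ (k *ₚ (P fz j *ₚ DP))
        ≈⟨ ≈sym (+-cong (*-congʳ r (·≈const* (sign (toℕ j)) _)) (*-congʳ s (·≈const* (sign (toℕ j)) _))) ⟩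
      r *ₚ laplaceTerm M j +ₚ s *ₚ laplaceTerm P j ∎
    where
    k = sign (toℕ j) ∷ []
    DN = det n (minor fz j N)
    DM = det n (minor fz j M)
    DP = det n (minor fz j P)
    j≢c' : j ≢ c
    j≢c' = j≢c
    c' = punchOut j≢c'
    pc : punchIn j c' ≡ c
    pc = punchIn-punchOut j≢c'
    nb : ∀ b → b ≢ c' → punchIn j b ≢ c
    nb b b≢c' eq = b≢c' (punchIn-injective j b c' (trans eq (sym pc)))
    IH : DN ≈ r *ₚ DM +ₚ s *ₚ DP
    IH = det-linearColumn n (minor fz j M) (minor fz j N) (minor fz j P) c' r s
      (λ a → subst (λ z → N (fs a) z ≈ r *ₚ M (fs a) z +ₚ s *ₚ P (fs a) z) (sym pc) (hc (fs a)))
      (λ a b b≢ → hM (fs a) (punchIn j b) (nb b b≢))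
      (λ a b b≢ → hP (fs a) (punchIn j b) (nb b b≢))

det-additiveColumn : ∀ n (M N P : PolyMatrix n) (c : Fin n)
  → (∀ a → N a c ≈ M a c +ₚ P a c)
  → (∀ a b → b ≢ c → N a b ≈ M a b)
  → (∀ a b → b ≢ c → N a b ≈ P a b)
  → det n N ≈ det n M +ₚ det n P
det-additiveColumn n M N P c hc hM hP =
  ≈trans (det-linearColumn n M N P c 1ₚ 1ₚ (λ a → ≈trans (hc a) (≈sym (+-cong (*-identityˡ (M a c)) (*-identityˡ (P a c))))) hM hP)
    (+-cong (*-identityˡ (det n M)) (*-identityˡ (det n P)))

det-zeroColumn : ∀ n (M : PolyMatrix n) c → (∀ a → M a c ≈ []) → det n M ≈ []
det-zeroColumn n M c h = det-linearColumn n M M M c [] [] h (λ _ _ _ → ≈refl) (λ _ _ _ → ≈refl)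

atColumn : ∀ {n} → Fin n → Fin n → Poly → Poly → Poly
atColumn c b x y with b Fin.≟ c
... | yes _ = x
... | no _ = y

atColumn-≡ : ∀ {n} (c : Fin n) x y → atColumn c c x y ≡ x
atColumn-≡ c x y with c Fin.≟ c
... | yes _ = refl
... | no ne = ⊥-elim (ne refl)

atColumn-≢ : ∀ {n} (c b : Fin n) x y → b ≢ c → atColumn c b x y ≡ y
atColumn-≢ c b x y ne with b Fin.≟ c
... | yes e = ⊥-elim (ne e)
... | no _ = refl

det-adjacentEqualColumns : ∀ n (M : PolyMatrix n) (c d : Fin n) → toℕ d ≡ suc (toℕ c) → (∀ a → M a c ≈ M a d) → det n M ≈ []
det-adjacentEqualColumns (suc n) M c d dc eq = ≈trans (det-laplace M) (≈trans (Σₚ-pair (laplaceTerm M) c d c≢d zt) tcd)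
  where
  c≢d : c ≢ d
  c≢d = toℕ-≢ (λ e → ℕP.<-irrefl (trans e dc) (ℕP.n<1+n (toℕ c)))
  zt : ∀ j → j ≢ c → j ≢ d → laplaceTerm M j ≈ []
  zt j j≢c j≢d = ≈trans (·-cong (sign (toℕ j)) (*-congʳ (M fz j) IH)) (≈trans (·-cong (sign (toℕ j)) (*-zeroʳ (M fz j))) ≈refl)
    where
    c' = punchOut j≢c
    d' = punchOut j≢d
    pc : toℕ (punchIn j c') ≡ toℕ c
    pc = cong toℕ (punchIn-punchOut j≢c)
    pd : toℕ (punchIn j d') ≡ toℕ d
    pd = cong toℕ (punchIn-punchOut j≢d)
    adj : toℕ d' ≡ suc (toℕ c')
    adj with toℕ-punchIn j c' | toℕ-punchIn j d'
    ... | inj₁ (_ , e1) | inj₁ (_ , e2) = trans (sym e2) (trans pd (trans dc (cong suc (trans (sym pc) e1))))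
    ... | inj₂ (_ , e1) | inj₂ (_ , e2) = ℕP.suc-injective (trans (sym e2) (trans pd (trans dc (cong suc (trans (sym pc) e1)))))
    ... | inj₁ (lt , e1) | inj₂ (ge , e2) = ⊥-elim (ℕP.<-irrefl x (ℕP.<-≤-trans lt ge))
      where
      x : toℕ c' ≡ toℕ d'
      x = ℕP.suc-injective (trans (cong suc (trans (sym e1) pc)) (trans (sym dc) (trans (sym pd) e2)))
    ... | inj₂ (ge , e1) | inj₁ (lt , e2) = ⊥-elim (ℕP.<⇒≱ (ℕP.<-≤-trans lt ge) (ℕP.≤-trans (ℕP.n≤1+n _) (ℕP.≤-trans (ℕP.n≤1+n _) (ℕP.≤-reflexive (sym x)))))
      where
      x : toℕ d' ≡ suc (suc (toℕ c'))
      x = trans (sym e2) (trans pd (trans dc (cong suc (trans (sym pc) e1))))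
    IH : det n (minor fz j M) ≈ []
    IH = det-adjacentEqualColumns n (minor fz j M) c' d' adj (λ a → subst₂ (λ u v → M (fs a) u ≈ M (fs a) v) (sym (punchIn-punchOut j≢c)) (sym
        (punchIn-punchOut j≢d)) (eq (fs a)))
  mcd : ∀ a b → M (fs a) (punchIn c b) ≈ M (fs a) (punchIn d b)
  mcd a b with toℕ-punchIn c b | toℕ-punchIn d b
  ... | inj₁ (_ , e1) | inj₁ (_ , e2) = ≡⇒≈ (cong (M (fs a)) (toℕ-injective (trans e1 (sym e2))))
  ... | inj₂ (_ , e1) | inj₂ (_ , e2) = ≡⇒≈ (cong (M (fs a)) (toℕ-injective (trans e1 (sym e2))))
  ... | inj₂ (ge , e1) | inj₁ (lt , e2) = subst₂ (λ u v → M (fs a) u ≈ M (fs a) v) (sym x1) (sym x2) (≈sym (eq (fs a)))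
    where
    bc : toℕ b ≡ toℕ c
    bc = ℕP.≤-antisym (ℕP.≤-pred (ℕP.≤-trans lt (ℕP.≤-reflexive dc))) ge
    x1 : punchIn c b ≡ d
    x1 = toℕ-injective (trans e1 (trans (cong suc bc) (sym dc)))
    x2 : punchIn d b ≡ c
    x2 = toℕ-injective (trans e2 bc)
  ... | inj₁ (lt , e1) | inj₂ (ge , e2) = ⊥-elim (ℕP.<⇒≱ lt (ℕP.≤-trans (ℕP.n≤1+n _) (ℕP.≤-trans (ℕP.≤-reflexive (sym dc)) ge)))
  tcd : laplaceTerm M c +ₚ laplaceTerm M d ≈ []
  tcd = ≈trans (+-congʳ (laplaceTerm M c) (≡⇒≈ (cong (λ z → sign z ·ₚ (M fz d *ₚ det n (minor fz d M))) dc)))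
         (sign-cancel (toℕ c) _ _ (*-cong (eq fz) (det-cong n mcd)))

replaceColumns : ∀ {n} (M : PolyMatrix n) (c d : Fin n) (f g : Fin n → Poly) → PolyMatrix n
replaceColumns M c d f g a b = atColumn c b (f a) (atColumn d b (g a) (M a b))

replaceColumns-first : ∀ {n} (M : PolyMatrix n) c d f g a → replaceColumns M c d f g a c ≡ f a
replaceColumns-first M c d f g a = atColumn-≡ c (f a) _

replaceColumns-notFirst : ∀ {n} (M : PolyMatrix n) c d f g a b → b ≢ c → replaceColumns M c d f g a b ≡ atColumn d b (g a) (M a b)
replaceColumns-notFirst M c d f g a b ne = atColumn-≢ c b (f a) _ ne

replaceColumns-second : ∀ {n} (M : PolyMatrix n) c d f g a → c ≢ d → replaceColumns M c d f g a d ≡ g a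
replaceColumns-second M c d f g a ne = trans (replaceColumns-notFirst M c d f g a d (ne ∘ sym)) (atColumn-≡ d (g a) _)

replaceColumns-notSecond : ∀ {n} (M : PolyMatrix n) c d f g a b → b ≢ d → replaceColumns M c d f g a b ≡ atColumn c b (f a) (M a b)
replaceColumns-notSecond M c d f g a b ne = cong (atColumn c b (f a)) (atColumn-≢ d b (g a) _ ne)

replaceColumns-other : ∀ {n} (M : PolyMatrix n) c d f g a b → b ≢ c → b ≢ d → replaceColumns M c d f g a b ≡ M a b
replaceColumns-other M c d f g a b n1 n2 = trans (replaceColumns-notSecond M c d f g a b n2) (atColumn-≢ c b (f a) _ n1)

column-trichotomy : ∀ {n} (b c d : Fin n) → (b ≡ c) ⊎ ((b ≡ d) ⊎ (b ≢ c × b ≢ d))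
column-trichotomy b c d with b Fin.≟ c | b Fin.≟ d
... | yes e | _ = inj₁ e
... | no _ | yes e = inj₂ (inj₁ e)
... | no n1 | no n2 = inj₂ (inj₂ (n1 , n2))

det-swapAdjacentColumns : ∀ n (M M' : PolyMatrix n) (c d : Fin n) → toℕ d ≡ suc (toℕ c)
  → (∀ a → M' a c ≈ M a d) → (∀ a → M' a d ≈ M a c) → (∀ a b → b ≢ c → b ≢ d → M' a b ≈ M a b)
  → det n M' +ₚ det n M ≈ []
det-swapAdjacentColumns n M M' c d dc hc hd ho = begin
    det n M' +ₚ det n M ≈⟨ +-cong (≈sym DX-swapped) (≈sym DX-original) ⟩
    DX v u +ₚ DX u v ≈⟨ +-comm (DX v u) (DX u v) ⟩
    DX u v +ₚ DX v u ≈⟨ +-cong (≈sym (+-congˡ (DX u v) (DX-equal u))) (≈sym (≈trans (+-congʳ (DX v u) (DX-equal v)) (+-identityʳ _))) ⟩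
    (DX u u +ₚ DX u v) +ₚ (DX v u +ₚ DX v v) ≈⟨ +-cong (≈sym (additive-second u u v)) (≈sym (additive-second v u v)) ⟩
    DX u w +ₚ DX v w ≈⟨ ≈sym (additive-first u v w) ⟩
    DX w w ≈⟨ DX-equal w ⟩
    [] ∎
  where
  c≢d : c ≢ d
  c≢d = toℕ-≢ (λ e → ℕP.<-irrefl (trans e dc) (ℕP.n<1+n (toℕ c)))
  u v w : Fin n → Poly
  u a = M a c
  v a = M a d
  w a = u a +ₚ v a
  X : (Fin n → Poly) → (Fin n → Poly) → PolyMatrix n
  X = replaceColumns M c d
  DX : (Fin n → Poly) → (Fin n → Poly) → Poly
  DX f g = det n (X f g)
  additive-first : ∀ f1 f2 g → DX (λ a → f1 a +ₚ f2 a) g ≈ DX f1 g +ₚ DX f2 g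
  additive-first f1 f2 g = det-additiveColumn n (X f1 g) (X (λ a → f1 a +ₚ f2 a) g) (X f2 g) c
    (λ a → ≡⇒≈ (trans (replaceColumns-first M c d (λ x → f1 x +ₚ f2 x) g a) (sym (cong₂ _+ₚ_ (replaceColumns-first M c d f1 g a) (replaceColumns-first M c d f2 g a)))))
    (λ a b ne → ≡⇒≈ (trans (replaceColumns-notFirst M c d (λ x → f1 x +ₚ f2 x) g a b ne) (sym (replaceColumns-notFirst M c d f1 g a b ne))))
    (λ a b ne → ≡⇒≈ (trans (replaceColumns-notFirst M c d (λ x → f1 x +ₚ f2 x) g a b ne) (sym (replaceColumns-notFirst M c d f2 g a b ne))))
  additive-second : ∀ f g1 g2 → DX f (λ a → g1 a +ₚ g2 a) ≈ DX f g1 +ₚ DX f g2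
  additive-second f g1 g2 = det-additiveColumn n (X f g1) (X f (λ a → g1 a +ₚ g2 a)) (X f g2) d
    (λ a → ≡⇒≈ (trans (replaceColumns-second M c d f (λ x → g1 x +ₚ g2 x) a c≢d) (sym (cong₂ _+ₚ_ (replaceColumns-second M c d f g1 a c≢d)
        (replaceColumns-second M c d f g2 a c≢d)))))
    (λ a b ne → ≡⇒≈ (trans (replaceColumns-notSecond M c d f (λ x → g1 x +ₚ g2 x) a b ne) (sym (replaceColumns-notSecond M c d f g1 a b ne))))
    (λ a b ne → ≡⇒≈ (trans (replaceColumns-notSecond M c d f (λ x → g1 x +ₚ g2 x) a b ne) (sym (replaceColumns-notSecond M c d f g2 a b ne))))
  DX-equal : ∀ f → DX f f ≈ []
  DX-equal f = det-adjacentEqualColumns n (X f f) c d dc (λ a → ≡⇒≈ (trans (replaceColumns-first M c d f f a) (sym (replaceColumns-second M c d f f a c≢d))))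
  DX-original : DX u v ≈ det n M
  DX-original = det-cong n λ a b → h a b (column-trichotomy b c d)
    where
    h : ∀ a b → (b ≡ c) ⊎ ((b ≡ d) ⊎ (b ≢ c × b ≢ d)) → X u v a b ≈ M a b
    h a b (inj₁ refl) = ≡⇒≈ (replaceColumns-first M c d u v a)
    h a b (inj₂ (inj₁ refl)) = ≡⇒≈ (replaceColumns-second M c d u v a c≢d)
    h a b (inj₂ (inj₂ (n1 , n2))) = ≡⇒≈ (replaceColumns-other M c d u v a b n1 n2)
  DX-swapped : DX v u ≈ det n M'
  DX-swapped = det-cong n λ a b → h a b (column-trichotomy b c d)
    where
    h : ∀ a b → (b ≡ c) ⊎ ((b ≡ d) ⊎ (b ≢ c × b ≢ d)) → X v u a b ≈ M' a b
    h a b (inj₁ refl) = ≈trans (≡⇒≈ (replaceColumns-first M c d v u a)) (≈sym (hc a))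
    h a b (inj₂ (inj₁ refl)) = ≈trans (≡⇒≈ (replaceColumns-second M c d v u a c≢d)) (≈sym (hd a))
    h a b (inj₂ (inj₂ (n1 , n2))) = ≈trans (≡⇒≈ (replaceColumns-other M c d v u a b n1 n2)) (≈sym (ho a b n1 n2))

det-equalColumnsAtDistance : ∀ k n (M : PolyMatrix n) (c d : Fin n) → toℕ d ≡ suc (k + toℕ c) → (∀ a → M a c ≈ M a d) → det n M ≈ []
det-equalColumnsAtDistance zero n M c d e eq = det-adjacentEqualColumns n M c d e eq
det-equalColumnsAtDistance (suc k) n M c d e eq = ≈trans (≈sym (+-congˡ (det n M) IH)) sw
  where
  lt : suc (k + toℕ c) < n
  lt = ℕP.≤-trans (ℕP.≤-reflexive (sym e)) (ℕP.<⇒≤ (toℕ<n d))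
  e' : Fin n
  e' = Fin.fromℕ< lt
  te : toℕ e' ≡ suc (k + toℕ c)
  te = toℕ-fromℕ< lt
  de : toℕ d ≡ suc (toℕ e')
  de = trans e (cong suc (sym te))
  F G : Fin n → Poly
  F a = M a d
  G a = M a e'
  M' : PolyMatrix n
  M' = replaceColumns M e' d F G
  e'≢d : e' ≢ d
  e'≢d = toℕ-≢ (λ x → ℕP.<-irrefl (trans x de) (ℕP.n<1+n _))
  c≢e' : c ≢ e'
  c≢e' = toℕ-≢ (λ x → ℕP.<-irrefl (trans x te) (s≤s (ℕP.m≤n+m (toℕ c) k)))
  c≢d : c ≢ d
  c≢d = toℕ-≢ (λ x → ℕP.<-irrefl (trans x (trans de (cong suc te))) (s≤s (ℕP.≤-trans (ℕP.m≤n+m (toℕ c) k) (ℕP.n≤1+n _))))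
  sw : det n M' +ₚ det n M ≈ []
  sw = det-swapAdjacentColumns n M M' e' d de (λ a → ≡⇒≈ (replaceColumns-first M e' d F G a)) (λ a → ≡⇒≈ (replaceColumns-second M e' d F G a e'≢d))
    (λ a b n1 n2 → ≡⇒≈ (replaceColumns-other M e' d F G a b n1 n2))
  IH : det n M' ≈ []
  IH = det-equalColumnsAtDistance k n M' c e' te (λ a → ≈trans (≡⇒≈ (replaceColumns-other M e' d (λ a → M a d) (λ a → M a e') a c c≢e' c≢d))
         (≈trans (eq a) (≡⇒≈ (sym (replaceColumns-first M e' d (λ a → M a d) (λ a → M a e') a)))))

det-equalColumns : ∀ n (M : PolyMatrix n) (c d : Fin n) → c ≢ d → (∀ a → M a c ≈ M a d) → det n M ≈ []
det-equalColumns n M c d c≢d eq with ℕP.<-cmp (toℕ c) (toℕ d)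
... | tri< lt _ _ = det-equalColumnsAtDistance (toℕ d ℕ.∸ suc (toℕ c)) n M c d
       (sym (trans (sym (ℕP.+-suc _ (toℕ c))) (ℕP.m∸n+n≡m lt))) eq
... | tri≈ _ e _ = ⊥-elim (c≢d (toℕ-injective e))
... | tri> _ _ gt = det-equalColumnsAtDistance (toℕ c ℕ.∸ suc (toℕ d)) n M d c
       (sym (trans (sym (ℕP.+-suc _ (toℕ d))) (ℕP.m∸n+n≡m gt))) (λ a → ≈sym (eq a))

det-addColumnMultiple : ∀ n (M N : PolyMatrix n) (c d : Fin n) (r : Poly) → c ≢ d
  → (∀ a → N a c ≈ M a c +ₚ r *ₚ M a d) → (∀ a b → b ≢ c → N a b ≈ M a b) → det n N ≈ det n M
det-addColumnMultiple n M N c d r c≢d hc ho = ≈trans lin (≈trans (+-cong (*-identityˡ (det n M)) (≈trans (*-congʳ r zP) (*-zeroʳ r))) (+-identityʳ _))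
  where
  P : PolyMatrix n
  P a b = atColumn c b (M a d) (M a b)
  zP : det n P ≈ []
  zP = det-equalColumns n P c d c≢d (λ a → ≡⇒≈ (trans (atColumn-≡ c (M a d) _) (sym (atColumn-≢ c d (M a d) _ (c≢d ∘ sym)))))
  lin : det n N ≈ 1ₚ *ₚ det n M +ₚ r *ₚ det n P
  lin = det-linearColumn n M N P c 1ₚ r
    (λ a → ≈trans (hc a) (+-cong (≈sym (*-identityˡ (M a c))) (*-congʳ r (≡⇒≈ (sym (atColumn-≡ c (M a d) _))))))
    ho
    (λ a b ne → ≈trans (ho a b ne) (≡⇒≈ (sym (atColumn-≢ c b (M a d) _ ne))))

sign-minorExchange : ∀ {n} r (c : Fin (suc (suc n))) (j' c' : Fin (suc n)) → punchIn (punchIn c j') c' ≡ c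
  → sign (toℕ (punchIn c j')) ℤ.* sign (r + toℕ c') ≡ sign (suc (r + toℕ c)) ℤ.* sign (toℕ j')
sign-minorExchange r c j' c' pc with toℕ-punchIn c j' | toℕ-punchIn (punchIn c j') c'
... | inj₁ (lt , e1) | inj₂ (ge , e2) =
  trans (cong₂ ℤ._*_ (cong sign e1) (sign-+ r (toℕ c')))
  (trans (arith (sign (toℕ j')) (sign r) (sign (toℕ c')))
  (cong (ℤ._* sign (toℕ j')) (sym (trans (sign-suc+ r c) (cong (λ z → - (sign r ℤ.* z)) sc≡-sc')))))
  where
  arith : ∀ x y z → x ℤ.* (y ℤ.* z) ≡ (- (y ℤ.* (- z))) ℤ.* x
  arith = solveℤ
  sc≡-sc' : sign (toℕ c) ≡ - sign (toℕ c')
  sc≡-sc' = trans (cong sign (trans (sym (cong toℕ pc)) e2)) (sign-suc (toℕ c'))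
... | inj₂ (ge , e1) | inj₁ (lt , e2) =
  trans (cong₂ ℤ._*_ (trans (cong sign e1) (sign-suc (toℕ j'))) (trans (sign-+ r (toℕ c')) (cong (λ z → sign r ℤ.* sign z) (trans (sym e2) (cong toℕ pc)))))
  (trans (arith (sign (toℕ j')) (sign r) (sign (toℕ c)))
  (cong (ℤ._* sign (toℕ j')) (sym (sign-suc+ r c))))
  where
  arith : ∀ x y z → (- x) ℤ.* (y ℤ.* z) ≡ (- (y ℤ.* z)) ℤ.* x
  arith = solveℤ
... | inj₁ (lt , e1) | inj₁ (lt2 , e2) =
  ⊥-elim (ℕP.<-asym (subst (_< toℕ (punchIn c j')) (trans (sym e2) (cong toℕ pc)) lt2) (subst (_< toℕ c) (sym e1) lt))
... | inj₂ (ge , e1) | inj₂ (ge2 , e2) =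
  ⊥-elim (ℕP.<-asym (subst (toℕ c <_) (sym e1) (s≤s ge)) (subst (suc (toℕ (punchIn c j')) ≤_) (trans (sym e2) (cong toℕ pc)) (s≤s ge2)))

det-singleEntryColumn : ∀ n (M : PolyMatrix (suc n)) (r c : Fin (suc n)) → (∀ a → a ≢ r → M a c ≈ [])
  → det (suc n) M ≈ sign (toℕ r + toℕ c) ·ₚ (M r c *ₚ det n (minor r c M))
det-singleEntryColumn n M fz c h = ≈trans (det-laplace M) (Σₚ-single (laplaceTerm M) c zt)
  where
  zt : ∀ j → j ≢ c → laplaceTerm M j ≈ []
  zt j j≢c = ·-cong (sign (toℕ j)) (≈trans (*-congʳ (M fz j) (det-zeroColumn n (minor fz j M) (punchOut j≢c)
     (λ a → subst (λ z → M (fs a) z ≈ []) (sym (punchIn-punchOut j≢c)) (h (fs a) (λ ()))))) (*-zeroʳ (M fz j)))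
det-singleEntryColumn (suc n) M (fs r) c h = begin
  det (suc (suc n)) M ≈⟨ det-laplace M ⟩
  Σₚ (laplaceTerm M) ≈⟨ Σₚ-punchIn (laplaceTerm M) c ⟩
  laplaceTerm M c +ₚ Σₚ (λ j' → laplaceTerm M (punchIn c j')) ≈⟨ +-congˡ (Σₚ (λ j' → laplaceTerm M (punchIn c j'))) tc0 ⟩
  Σₚ (λ j' → laplaceTerm M (punchIn c j')) ≈⟨ Σₚ-cong {f = λ j' → laplaceTerm M (punchIn c j')} pt ⟩
  Σₚ (λ j' → K ·ₚ (X *ₚ laplaceTerm (minor (fs r) c M) j')) ≈⟨ Σₚ-scale K X (laplaceTerm (minor (fs r) c M)) ⟩
  K ·ₚ (X *ₚ Σₚ (laplaceTerm (minor (fs r) c M))) ≈⟨ ·-cong K (*-congʳ X (≈sym (det-laplace (minor (fs r) c M)))) ⟩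
  K ·ₚ (X *ₚ det (suc n) (minor (fs r) c M)) ∎
  where
  K = sign (suc (toℕ r + toℕ c))
  X = M (fs r) c
  tc0 : laplaceTerm M c ≈ []
  tc0 = ·-cong (sign (toℕ c)) (*-congˡ (det (suc n) (minor fz c M)) (h fz (λ ())))
  pt : ∀ j' → laplaceTerm M (punchIn c j') ≈ K ·ₚ (X *ₚ laplaceTerm (minor (fs r) c M) j')
  pt j' = begin
      sign (toℕ j) ·ₚ (M fz j *ₚ det (suc n) (minor fz j M))
        ≈⟨ ·-cong (sign (toℕ j)) (*-congʳ (M fz j) IH) ⟩
      sign (toℕ j) ·ₚ (M fz j *ₚ (sign (toℕ r + toℕ c') ·ₚ (M (fs r) (punchIn j c') *ₚ D1)))
        ≈⟨ ≡⇒≈ (cong (λ z → sign (toℕ j) ·ₚ (M fz j *ₚ (sign (toℕ r + toℕ c') ·ₚ (M (fs r) z *ₚ D1)))) pc) ⟩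
      sign (toℕ j) ·ₚ (M fz j *ₚ (sign (toℕ r + toℕ c') ·ₚ (X *ₚ D1)))
        ≈⟨ ·-cong (sign (toℕ j)) (*-congʳ (M fz j) (·-cong (sign (toℕ r + toℕ c')) (*-congʳ X D12))) ⟩
      sign (toℕ j) ·ₚ (M fz j *ₚ (sign (toℕ r + toℕ c') ·ₚ (X *ₚ D2)))
        ≈⟨ ·-*-·-exchange (sign (toℕ j)) (sign (toℕ r + toℕ c')) K (sign (toℕ j')) (M fz j) X D2 (sign-minorExchange (toℕ r) c j' c' pc) ⟩
      K ·ₚ (X *ₚ (sign (toℕ j') ·ₚ (M fz j *ₚ D2))) ∎
    where
    j = punchIn c j'
    j≢c : j ≢ c
    j≢c = punchInᵢ≢i c j'
    c' = punchOut j≢c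
    pc : punchIn j c' ≡ c
    pc = punchIn-punchOut j≢c
    D1 = det n (minor r c' (minor fz j M))
    D2 = det n (minor fz j' (minor (fs r) c M))
    IH : det (suc n) (minor fz j M) ≈ sign (toℕ r + toℕ c') ·ₚ (M (fs r) (punchIn j c') *ₚ D1)
    IH = det-singleEntryColumn n (minor fz j M) r c' (λ a a≢r → subst (λ z → M (fs a) z ≈ []) (sym pc) (h (fs a) (a≢r ∘ suc-injective)))
    D12 : D1 ≈ D2
    D12 = det-cong n (λ a b → ≡⇒≈ (cong (M (fs (punchIn r a))) (punchIn-punchIn-comm c j' c' pc b)))

det-additiveRow : ∀ n (M N P : PolyMatrix n) (r : Fin n) → (∀ b → N r b ≈ M r b +ₚ P r b)
  → (∀ a b → a ≢ r → N a b ≈ M a b) → (∀ a b → a ≢ r → N a b ≈ P a b)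
  → det n N ≈ det n M +ₚ det n P
det-additiveRow (suc n) M N P fz hr hM hP =
  ≈trans (det-laplace N) (≈trans (Σₚ-cong {f = laplaceTerm N} pt) (≈trans (Σₚ-+ (laplaceTerm M) (laplaceTerm P)) (+-cong (≈sym (det-laplace M)) (≈sym (det-laplace P)))))
  where
  pt : ∀ j → laplaceTerm N j ≈ laplaceTerm M j +ₚ laplaceTerm P j
  pt j = begin
    sign (toℕ j) ·ₚ (N fz j *ₚ DN) ≈⟨ ·-cong (sign (toℕ j)) (*-congˡ DN (hr j)) ⟩
    sign (toℕ j) ·ₚ ((M fz j +ₚ P fz j) *ₚ DN) ≈⟨ ·-cong (sign (toℕ j)) (*-distribʳ (M fz j) (P fz j) DN) ⟩
    sign (toℕ j) ·ₚ (M fz j *ₚ DN +ₚ P fz j *ₚ DN) ≈⟨ ·-distrib-+ (sign (toℕ j)) (M fz j *ₚ DN) (P fz j *ₚ DN) ⟩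
    sign (toℕ j) ·ₚ (M fz j *ₚ DN) +ₚ sign (toℕ j) ·ₚ (P fz j *ₚ DN)
      ≈⟨ +-cong (·-cong (sign (toℕ j)) (*-congʳ (M fz j) eM)) (·-cong (sign (toℕ j)) (*-congʳ (P fz j) eP)) ⟩
    laplaceTerm M j +ₚ laplaceTerm P j ∎
    where
    DN = det n (minor fz j N)
    eM : DN ≈ det n (minor fz j M)
    eM = det-cong n (λ a b → hM (fs a) (punchIn j b) (λ ()))
    eP : DN ≈ det n (minor fz j P)
    eP = det-cong n (λ a b → hP (fs a) (punchIn j b) (λ ()))
det-additiveRow (suc n) M N P (fs r) hr hM hP =
  ≈trans (det-laplace N) (≈trans (Σₚ-cong {f = laplaceTerm N} pt) (≈trans (Σₚ-+ (laplaceTerm M) (laplaceTerm P)) (+-cong (≈sym (det-laplace M)) (≈sym (det-laplace P)))))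
  where
  pt : ∀ j → laplaceTerm N j ≈ laplaceTerm M j +ₚ laplaceTerm P j
  pt j = begin
    sign (toℕ j) ·ₚ (N fz j *ₚ DN) ≈⟨ ·-cong (sign (toℕ j)) (*-congʳ (N fz j) IH) ⟩
    sign (toℕ j) ·ₚ (N fz j *ₚ (DM +ₚ DP)) ≈⟨ ·-cong (sign (toℕ j)) (*-distribˡ (N fz j) DM DP) ⟩
    sign (toℕ j) ·ₚ (N fz j *ₚ DM +ₚ N fz j *ₚ DP) ≈⟨ ·-distrib-+ (sign (toℕ j)) (N fz j *ₚ DM) (N fz j *ₚ DP) ⟩
    sign (toℕ j) ·ₚ (N fz j *ₚ DM) +ₚ sign (toℕ j) ·ₚ (N fz j *ₚ DP)
      ≈⟨ +-cong (·-cong (sign (toℕ j)) (*-congˡ DM (hM fz j (λ ())))) (·-cong (sign (toℕ j)) (*-congˡ DP (hP fz j (λ ())))) ⟩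
    laplaceTerm M j +ₚ laplaceTerm P j ∎
    where
    DN = det n (minor fz j N)
    DM = det n (minor fz j M)
    DP = det n (minor fz j P)
    IH : DN ≈ DM +ₚ DP
    IH = det-additiveRow n (minor fz j M) (minor fz j N) (minor fz j P) r (λ b → hr (punchIn j b))
      (λ a b a≢r → hM (fs a) (punchIn j b) (a≢r ∘ suc-injective))
      (λ a b a≢r → hP (fs a) (punchIn j b) (a≢r ∘ suc-injective))

det-singleEntryFirstRow : ∀ n (M : PolyMatrix (suc n)) (c : Fin (suc n)) → (∀ b → b ≢ c → M fz b ≈ [])
  → det (suc n) M ≈ sign (toℕ c) ·ₚ (M fz c *ₚ det n (minor fz c M))
det-singleEntryFirstRow n M c h = ≈trans (det-laplace M) (Σₚ-single (laplaceTerm M) c (λ j j≢c → ·-cong (sign (toℕ j)) (*-congˡ (det n (minor fz j M)) (h j j≢c))))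

unitColumn : ℕ → ℕ → Poly
unitColumn q i with i ℕ.≟ q
... | yes _ = 1ₚ
... | no _ = []

unitColumn-≡ : ∀ q → unitColumn q q ≡ 1ₚ
unitColumn-≡ q with q ℕ.≟ q
... | yes _ = refl
... | no ne = ⊥-elim (ne refl)

unitColumn-≢ : ∀ q i → i ≢ q → unitColumn q i ≡ []
unitColumn-≢ q i ne with i ℕ.≟ q
... | yes e = ⊥-elim (ne e)
... | no _ = refl

replaceColumn : ∀ {n} → PolyMatrix n → Fin n → (Fin n → Poly) → PolyMatrix n
replaceColumn M c f a b = atColumn c b (f a) (M a b)

eigMult-intro : ∀ n (A : Matrix n) λ₀ e q → charPoly n A ≈ ((X- λ₀) ^ₚ e) *ₚ q → NonRootAt λ₀ q → EigMult n A λ₀ e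
eigMult-intro n A λ₀ e q factorisation nonRootq = q , at factorisation , eval≢0 nonRootq

≡⊎≢ : ∀ (i j : ℕ) → (i ≡ j) ⊎ (i ≢ j)
≡⊎≢ i j with i ℕ.≟ j
... | yes e = inj₁ e
... | no ne = inj₂ ne

<+2⇒< : ∀ {i q} → i < q + 2 → i ≢ q → i ≢ suc q → i < q
<+2⇒< {i} {q} lt n1 n2 with ℕP.m≤n⇒m<n∨m≡n (ℕP.≤-pred (subst (suc i ≤_) (ℕP.+-comm q 2) lt))
... | inj₂ e = ⊥-elim (n2 e)
... | inj₁ lt' with ℕP.m≤n⇒m<n∨m≡n (ℕP.≤-pred lt')
... | inj₂ e = ⊥-elim (n1 e)
... | inj₁ lt'' = lt''

-- A cell stands for `weight` merged twins with label `label`; `loop` is the diagonal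
-- entry of the quotient matrix, ε · (weight − 1) for twins of mutual adjacency ε.
record Cell (h : ℕ) : Set where
  constructor cell
  field
    label : Label h
    weight : ℤ
    loop : ℤ
open Cell public

module CellMatrices (k : ℕ) where

  Cellₖ : Set
  Cellₖ = Cell (suc k)

  defaultCell : Cellₖ
  defaultCell = cell (uL fz) (+ 0) (+ 0)

  -- Out-of-range indices return a junk cell; every use is guarded by a bound.
  cellAt : List Cellₖ → ℕ → Cellₖ
  cellAt [] i = defaultCell
  cellAt (e ∷ L) zero = e
  cellAt (e ∷ L) (suc i) = cellAt L i

  diagonalEntry : Poly → Cellₖ → Poly
  diagonalEntry Xp e = ((- loop e) ∷ []) +ₚ Xp

  offDiagonalEntry : Cellₖ → Cellₖ → Poly
  offDiagonalEntry e f = (- (weight e ℤ.* adjL (label e) (label f))) ∷ []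

  -- `Xp` is substituted for x: `Xₚ` gives xI − B, a constant ⟨c⟩ gives cI − B.
  charEntry : Poly → List Cellₖ → ℕ → ℕ → Poly
  charEntry Xp L i j with i ℕ.≟ j
  ... | yes _ = diagonalEntry Xp (cellAt L i)
  ... | no _ = offDiagonalEntry (cellAt L i) (cellAt L j)

  charMatrix : Poly → List Cellₖ → (n : ℕ) → PolyMatrix n
  charMatrix Xp L n a b = charEntry Xp L (toℕ a) (toℕ b)

  charDet : Poly → List Cellₖ → Poly
  charDet Xp L = det (length L) (charMatrix Xp L (length L))

  charDet-length : ∀ Xp L m → length L ≡ m → charDet Xp L ≡ det m (charMatrix Xp L m)
  charDet-length Xp L m refl = refl

  charEntry-diagonal : ∀ Xp L i → charEntry Xp L i i ≡ diagonalEntry Xp (cellAt L i)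
  charEntry-diagonal Xp L i with i ℕ.≟ i
  ... | yes _ = refl
  ... | no ne = ⊥-elim (ne refl)

  charEntry-offDiagonal : ∀ Xp L i j → i ≢ j → charEntry Xp L i j ≡ offDiagonalEntry (cellAt L i) (cellAt L j)
  charEntry-offDiagonal Xp L i j ne with i ℕ.≟ j
  ... | yes e = ⊥-elim (ne e)
  ... | no _ = refl

  cellAt-++ : ∀ (P : List Cellₖ) x X → cellAt (P ++ x ∷ X) (length P) ≡ x
  cellAt-++ [] x X = refl
  cellAt-++ (e ∷ P) x X = cellAt-++ P x X

  cellAt-++-suc : ∀ (P : List Cellₖ) x y X → cellAt (P ++ x ∷ y ∷ X) (suc (length P)) ≡ y
  cellAt-++-suc [] x y X = refl
  cellAt-++-suc (e ∷ P) x y X = cellAt-++-suc P x y X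

  cellAt-merged : ∀ (P Suf : List Cellₖ) e1 e2 e12 i i' → PunchedAt (length P) i i' → i ≢ length P
    → cellAt (P ++ e12 ∷ Suf) i ≡ cellAt (P ++ e1 ∷ e2 ∷ Suf) i'
  cellAt-merged [] Suf e1 e2 e12 i i' (inj₁ (() , _)) ne
  cellAt-merged [] Suf e1 e2 e12 zero i' (inj₂ (_ , e)) ne = ⊥-elim (ne refl)
  cellAt-merged [] Suf e1 e2 e12 (suc i) i' (inj₂ (_ , refl)) ne = refl
  cellAt-merged (x ∷ P) Suf e1 e2 e12 zero i' (inj₁ (_ , refl)) ne = refl
  cellAt-merged (x ∷ P) Suf e1 e2 e12 zero i' (inj₂ (() , _)) ne
  cellAt-merged (x ∷ P) Suf e1 e2 e12 (suc i) i' (inj₁ (s≤s lt , refl)) ne = cellAt-merged P Suf e1 e2 e12 i i (inj₁ (lt , refl)) (ne ∘ cong suc)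
  cellAt-merged (x ∷ P) Suf e1 e2 e12 (suc i) i' (inj₂ (s≤s ge , refl)) ne = cellAt-merged P Suf e1 e2 e12 i (suc i) (inj₂ (ge , refl)) (ne ∘ cong suc)

  Twins : Label (suc k) → Label (suc k) → Cellₖ → Set
  Twins ℓ1 ℓ2 e = (adjL (label e) ℓ1 ≡ adjL (label e) ℓ2) × (adjL ℓ1 (label e) ≡ adjL ℓ2 (label e))

  +-rotate : ∀ A X B → (A +ₚ X) +ₚ B ≈ X +ₚ (A +ₚ B)
  +-rotate = RS.solve-∀ poly-almostCommutativeRing
  +-*-regroup : ∀ C M1 A X → C +ₚ M1 *ₚ (A +ₚ X) ≈ (C +ₚ M1 *ₚ A) +ₚ M1 *ₚ X
  +-*-regroup = RS.solve-∀ poly-almostCommutativeRing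
  *-factorʳ : ∀ M1 Eps X → M1 *ₚ Eps +ₚ M1 *ₚ X ≈ (X +ₚ Eps) *ₚ M1
  *-factorʳ = RS.solve-∀ poly-almostCommutativeRing
  *-collect : ∀ r X Y M1 → r *ₚ X +ₚ (r *ₚ M1) *ₚ (M1 *ₚ Y) ≈ r *ₚ (X +ₚ (M1 *ₚ M1) *ₚ Y)
  *-collect = RS.solve-∀ poly-almostCommutativeRing

  combineMinors : ∀ r X Y → r *ₚ (+ 1 ·ₚ (1ₚ *ₚ X)) +ₚ (r *ₚ ⟨-1⟩) *ₚ ((- (+ 1)) ·ₚ (1ₚ *ₚ Y)) ≈ r *ₚ (X +ₚ Y)
  combineMinors r X Y = begin
    r *ₚ (+ 1 ·ₚ (1ₚ *ₚ X)) +ₚ (r *ₚ ⟨-1⟩) *ₚ ((- (+ 1)) ·ₚ (1ₚ *ₚ Y))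
      ≈⟨ +-cong (*-congʳ r (≈trans (·-identityˡ _) (*-identityˡ X))) (*-congʳ (r *ₚ ⟨-1⟩) (≈trans (·-cong (- (+ 1)) (*-identityˡ Y)) (·≈const* (- (+ 1)) Y))) ⟩
    r *ₚ X +ₚ (r *ₚ ⟨-1⟩) *ₚ (⟨-1⟩ *ₚ Y) ≈⟨ *-collect r X Y ⟨-1⟩ ⟩
    r *ₚ (X +ₚ (⟨-1⟩ *ₚ ⟨-1⟩) *ₚ Y) ≈⟨ *-congʳ r (+-congʳ X (*-identityˡ Y)) ⟩
    r *ₚ (X +ₚ Y) ∎

  module MergeTwins (Xp : Poly) (P Suf : List Cellₖ) (ℓ1 ℓ2 : Label (suc k)) (w1 w2 d1 d2 ε : ℤ)
    (h12 : adjL ℓ1 ℓ2 ≡ ε) (h21 : adjL ℓ2 ℓ1 ≡ ε) (hd1 : d1 ℤ.+ ε ≡ ε ℤ.* w1) (hd2 : d2 ℤ.+ ε ≡ ε ℤ.* w2)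
    (tw : ∀ i → i < length (P ++ cell ℓ1 w1 d1 ∷ cell ℓ2 w2 d2 ∷ Suf) → i ≢ length P → i ≢ suc (length P)
          → Twins ℓ1 ℓ2 (cellAt (P ++ cell ℓ1 w1 d1 ∷ cell ℓ2 w2 d2 ∷ Suf) i)) where
    e1 e2 e12 : Cellₖ
    e1 = cell ℓ1 w1 d1
    e2 = cell ℓ2 w2 d2
    e12 = cell ℓ2 (w1 ℤ.+ w2) (d2 ℤ.+ ε ℤ.* w1)
    L L' : List Cellₖ
    L = P ++ e1 ∷ e2 ∷ Suf
    L' = P ++ e12 ∷ Suf
    q n : ℕ
    q = length P
    n = q + length Suf
    lenL : length L ≡ suc (suc n)
    lenL = trans (LP.length-++ P) (trans (ℕP.+-suc q _) (cong suc (ℕP.+-suc q _)))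
    lenL' : length L' ≡ suc n
    lenL' = trans (LP.length-++ P) (ℕP.+-suc q _)
    r s : Poly
    r = Xp +ₚ (ε ∷ [])
    s = r *ₚ ⟨-1⟩
    q≢1+q : q ≢ suc q
    q≢1+q = ℕP.1+n≢n ∘ sym

    cellAt-q : cellAt L q ≡ e1
    cellAt-q = cellAt-++ P e1 (e2 ∷ Suf)
    cellAt-suc-q : cellAt L (suc q) ≡ e2
    cellAt-suc-q = cellAt-++-suc P e1 e2 Suf
    cellAt′-q : cellAt L' q ≡ e12
    cellAt′-q = cellAt-++ P e12 Suf

    position-trichotomy : ∀ i → (i ≡ q) ⊎ ((i ≢ q × i ≡ suc q) ⊎ (i ≢ q × i ≢ suc q))
    position-trichotomy i with i ℕ.≟ q | i ℕ.≟ suc q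
    ... | yes e | _ = inj₁ e
    ... | no n1 | yes e = inj₂ (inj₁ (n1 , e))
    ... | no n1 | no n2 = inj₂ (inj₂ (n1 , n2))

    -- The twins agree outside the pair, so column q minus column q + 1 is (x + ε)(e_q − e_{q+1}).
    columnDifference : ∀ i → i < suc (suc n) → charEntry Xp L i q +ₚ ⟨-1⟩ *ₚ charEntry Xp L i (suc q) ≈ r *ₚ unitColumn q i +ₚ s *ₚ unitColumn (suc q) i
    columnDifference i lt = cf i lt (position-trichotomy i)
      where
      cf : ∀ i → i < suc (suc n) → (i ≡ q) ⊎ ((i ≢ q × i ≡ suc q) ⊎ (i ≢ q × i ≢ suc q)) → charEntry Xp L i q +ₚ ⟨-1⟩ *ₚ charEntry Xp L i
          (suc q) ≈ r *ₚ unitColumn q i +ₚ s *ₚ unitColumn (suc q) i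
      cf i lt (inj₁ refl) = begin
          charEntry Xp L q q +ₚ ⟨-1⟩ *ₚ charEntry Xp L q (suc q)
            ≈⟨ ≡⇒≈ (cong₂ (λ u v → u +ₚ ⟨-1⟩ *ₚ v) (trans (charEntry-diagonal Xp L q) (cong (diagonalEntry Xp) cellAt-q))
                   (trans (charEntry-offDiagonal Xp L q (suc q) q≢1+q) (cong₂ offDiagonalEntry cellAt-q cellAt-suc-q))) ⟩
          (((- d1) ∷ []) +ₚ Xp) +ₚ ⟨-1⟩ *ₚ ((- (w1 ℤ.* adjL ℓ1 ℓ2)) ∷ []) ≈⟨ +-rotate ((- d1) ∷ []) Xp (⟨-1⟩ *ₚ ((- (w1 ℤ.* adjL ℓ1 ℓ2)) ∷ [])) ⟩
          Xp +ₚ ((- d1) ℤ.+ ((- (+ 1)) ℤ.* (- (w1 ℤ.* adjL ℓ1 ℓ2)) ℤ.+ + 0) ∷ []) ≈⟨ +-congʳ Xp (const-cong pivotColumn≡ε) ⟩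
          r ≈⟨ ≈sym (≈trans (+-cong (*-identityʳ r) (*-zeroʳ s)) (+-identityʳ r)) ⟩
          r *ₚ 1ₚ +ₚ s *ₚ [] ≈⟨ ≡⇒≈ (sym (cong₂ (λ u v → r *ₚ u +ₚ s *ₚ v) (unitColumn-≡ q) (unitColumn-≢ (suc q) q q≢1+q))) ⟩
          r *ₚ unitColumn q q +ₚ s *ₚ unitColumn (suc q) q ∎
        where
        pivotColumn≡ε : (- d1) ℤ.+ ((- (+ 1)) ℤ.* (- (w1 ℤ.* adjL ℓ1 ℓ2)) ℤ.+ + 0) ≡ ε
        pivotColumn≡ε = trans (cong (λ z → (- d1) ℤ.+ ((- (+ 1)) ℤ.* (- (w1 ℤ.* z)) ℤ.+ + 0)) h12)
          (trans (arith d1 w1 ε) (trans (cong (λ z → z ℤ.+ (- d1)) (sym hd1)) (arith₂ d1 ε)))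
          where
          arith : ∀ d w e → (- d) ℤ.+ ((- (+ 1)) ℤ.* (- (w ℤ.* e)) ℤ.+ + 0) ≡ e ℤ.* w ℤ.+ (- d)
          arith = solveℤ
          arith₂ : ∀ d e → d ℤ.+ e ℤ.+ (- d) ≡ e
          arith₂ = solveℤ
      cf i lt (inj₂ (inj₁ (i≢q , refl))) = begin
          charEntry Xp L (suc q) q +ₚ ⟨-1⟩ *ₚ charEntry Xp L (suc q) (suc q)
            ≈⟨ ≡⇒≈ (cong₂ (λ u v → u +ₚ ⟨-1⟩ *ₚ v) (trans (charEntry-offDiagonal Xp L (suc q) q i≢q) (cong₂ offDiagonalEntry cellAt-suc-q cellAt-q))
                   (trans (charEntry-diagonal Xp L (suc q)) (cong (diagonalEntry Xp) cellAt-suc-q))) ⟩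
          ((- (w2 ℤ.* adjL ℓ2 ℓ1)) ∷ []) +ₚ ⟨-1⟩ *ₚ (((- d2) ∷ []) +ₚ Xp) ≈⟨ +-*-regroup ((- (w2 ℤ.* adjL ℓ2 ℓ1)) ∷ []) ⟨-1⟩ ((- d2) ∷ []) Xp ⟩
          (((- (w2 ℤ.* adjL ℓ2 ℓ1)) ∷ []) +ₚ ⟨-1⟩ *ₚ ((- d2) ∷ [])) +ₚ ⟨-1⟩ *ₚ Xp ≈⟨ +-congˡ (⟨-1⟩ *ₚ Xp) (const-cong twinColumn≡-ε) ⟩
          ⟨-1⟩ *ₚ (ε ∷ []) +ₚ ⟨-1⟩ *ₚ Xp ≈⟨ *-factorʳ ⟨-1⟩ (ε ∷ []) Xp ⟩
          s ≈⟨ ≈sym (≈trans (+-congˡ (s *ₚ 1ₚ) (*-zeroʳ r)) (*-identityʳ s)) ⟩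
          r *ₚ [] +ₚ s *ₚ 1ₚ ≈⟨ ≡⇒≈ (sym (cong₂ (λ u v → r *ₚ u +ₚ s *ₚ v) (unitColumn-≢ q (suc q) i≢q) (unitColumn-≡ (suc q)))) ⟩
          r *ₚ unitColumn q (suc q) +ₚ s *ₚ unitColumn (suc q) (suc q) ∎
        where
        twinColumn≡-ε : (- (w2 ℤ.* adjL ℓ2 ℓ1)) ℤ.+ ((- (+ 1)) ℤ.* (- d2) ℤ.+ + 0) ≡ (- (+ 1)) ℤ.* ε ℤ.+ + 0
        twinColumn≡-ε = trans (cong (λ z → (- (w2 ℤ.* z)) ℤ.+ ((- (+ 1)) ℤ.* (- d2) ℤ.+ + 0)) h21)
          (trans (arith d2 w2 ε) (trans (cong (λ z → (- z) ℤ.+ d2) (sym hd2)) (arith₂ d2 ε)))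
          where
          arith : ∀ d w e → (- (w ℤ.* e)) ℤ.+ ((- (+ 1)) ℤ.* (- d) ℤ.+ + 0) ≡ (- (e ℤ.* w)) ℤ.+ d
          arith = solveℤ
          arith₂ : ∀ d e → (- (d ℤ.+ e)) ℤ.+ d ≡ (- (+ 1)) ℤ.* e ℤ.+ + 0
          arith₂ = solveℤ
      cf i lt (inj₂ (inj₂ (i≢q , i≢q1))) = begin
          charEntry Xp L i q +ₚ ⟨-1⟩ *ₚ charEntry Xp L i (suc q)
            ≈⟨ ≡⇒≈ (cong₂ (λ u v → u +ₚ ⟨-1⟩ *ₚ v) (trans (charEntry-offDiagonal Xp L i q i≢q) (cong (offDiagonalEntry (cellAt L i)) cellAt-q))
                   (trans (charEntry-offDiagonal Xp L i (suc q) i≢q1) (cong (offDiagonalEntry (cellAt L i)) cellAt-suc-q))) ⟩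
          offDiagonalEntry (cellAt L i) e1 +ₚ ⟨-1⟩ *ₚ offDiagonalEntry (cellAt L i) e2 ≈⟨ const-cong otherColumn≡0 ⟩
          + 0 ∷ [] ≈⟨ mk (λ { zero → refl ; (suc j) → refl }) ⟩
          [] ≈⟨ ≈sym (≈trans (+-cong (*-zeroʳ r) (*-zeroʳ s)) ≈refl) ⟩
          r *ₚ [] +ₚ s *ₚ [] ≈⟨ ≡⇒≈ (sym (cong₂ (λ u v → r *ₚ u +ₚ s *ₚ v) (unitColumn-≢ q i i≢q) (unitColumn-≢ (suc q) i i≢q1))) ⟩
          r *ₚ unitColumn q i +ₚ s *ₚ unitColumn (suc q) i ∎
        where
        t = proj₁ (tw i (subst (i <_) (sym lenL) lt) i≢q i≢q1)
        otherColumn≡0 : (- (weight (cellAt L i) ℤ.* adjL (label (cellAt L i)) ℓ1)) ℤ.+ ((- (+ 1)) ℤ.* (- (weight (cellAt L i) ℤ.* adjL (label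
            (cellAt L i)) ℓ2)) ℤ.+ + 0) ≡ + 0
        otherColumn≡0 = trans (cong (λ z → (- (weight (cellAt L i) ℤ.* z)) ℤ.+ ((- (+ 1)) ℤ.* (- (weight (cellAt L i) ℤ.* adjL (label
            (cellAt L i)) ℓ2)) ℤ.+ + 0)) t) (arith (weight (cellAt L i)) (adjL (label (cellAt L i)) ℓ2))
          where
          arith : ∀ w a → (- (w ℤ.* a)) ℤ.+ ((- (+ 1)) ℤ.* (- (w ℤ.* a)) ℤ.+ + 0) ≡ + 0
          arith = solveℤ

    offDiagonalEntry-label : ∀ e f f' → label f ≡ label f' → offDiagonalEntry e f ≡ offDiagonalEntry e f'
    offDiagonalEntry-label e f f' x = cong (λ z → (- (weight e ℤ.* adjL (label e) z)) ∷ []) x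

    punchedAt-q : PunchedAt q q (suc q)
    punchedAt-q = inj₂ (ℕP.≤-refl , refl)

    label-merged : ∀ j j' → PunchedAt q j j' → label (cellAt L' j) ≡ label (cellAt L j')
    label-merged j j' h with j ℕ.≟ q
    ... | yes refl = trans (cong label cellAt′-q) (sym (cong label (trans (cong (cellAt L) (PunchedAt-functional h punchedAt-q)) cellAt-suc-q)))
    ... | no ne = cong label (cellAt-merged P Suf e1 e2 e12 j j' h ne)

    charEntry-merged : ∀ i i' j j' → i ≢ q → PunchedAt q i i' → PunchedAt q j j' → charEntry Xp L' i j ≡ charEntry Xp L i' j'
    charEntry-merged i i' j j' ne hi hj = f (≡⊎≢ i j)
      where
      f : (i ≡ j) ⊎ (i ≢ j) → charEntry Xp L' i j ≡ charEntry Xp L i' j'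
      f (inj₁ refl) = trans (charEntry-diagonal Xp L' i) (trans (cong (diagonalEntry Xp) (cellAt-merged P Suf e1 e2 e12 i i' hi ne))
                        (trans (sym (charEntry-diagonal Xp L i')) (cong (charEntry Xp L i') (PunchedAt-functional hi hj))))
      f (inj₂ i≢j) = trans (charEntry-offDiagonal Xp L' i j i≢j) (trans (cong (λ z → offDiagonalEntry z (cellAt L' j)) (cellAt-merged P Suf e1 e2 e12 i i' hi ne))
                        (trans (offDiagonalEntry-label (cellAt L i') (cellAt L' j) (cellAt L j') (label-merged j j' hj)) (sym
                            (charEntry-offDiagonal Xp L i' j' (λ x → i≢j (PunchedAt-injective hi hj x))))))

    neg-distrib-loop : ∀ a b c → - (a ℤ.+ c ℤ.* b) ≡ (- a) ℤ.+ (- (b ℤ.* c))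
    neg-distrib-loop = solveℤ
    neg-distrib-weight : ∀ w1 w2 x → - ((w1 ℤ.+ w2) ℤ.* x) ≡ (- (w2 ℤ.* x)) ℤ.+ (- (w1 ℤ.* x))
    neg-distrib-weight = solveℤ

    charEntry-mergedRow : ∀ j j' → PunchedAt q j j' → j' < suc (suc n) → charEntry Xp L' q j ≈ charEntry Xp L (suc q) j' +ₚ charEntry Xp L q j'
    charEntry-mergedRow j j' hj lt = f (≡⊎≢ j q)
      where
      f : (j ≡ q) ⊎ (j ≢ q) → charEntry Xp L' q j ≈ charEntry Xp L (suc q) j' +ₚ charEntry Xp L q j'
      f (inj₁ refl) = begin
          charEntry Xp L' q q ≈⟨ ≡⇒≈ (trans (charEntry-diagonal Xp L' q) (cong (diagonalEntry Xp) cellAt′-q)) ⟩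
          ((- (d2 ℤ.+ ε ℤ.* w1)) ∷ []) +ₚ Xp ≈⟨ +-comm ((- (d2 ℤ.+ ε ℤ.* w1)) ∷ []) Xp ⟩
          Xp +ₚ ((- (d2 ℤ.+ ε ℤ.* w1)) ∷ []) ≈⟨ +-congʳ Xp (const-cong (trans (neg-distrib-loop d2 w1 ε) (cong (λ z → (- d2) ℤ.+ (- (w1 ℤ.* z))) (sym h12)))) ⟩
          Xp +ₚ (((- d2) ∷ []) +ₚ offDiagonalEntry e1 e2) ≈⟨ ≈sym (+-rotate ((- d2) ∷ []) Xp (offDiagonalEntry e1 e2)) ⟩
          diagonalEntry Xp e2 +ₚ offDiagonalEntry e1 e2
            ≈⟨ ≡⇒≈ (sym (cong₂ _+ₚ_ (trans (cong (charEntry Xp L (suc q)) jj) (trans (charEntry-diagonal Xp L (suc q)) (cong (diagonalEntry Xp) cellAt-suc-q)))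
                     (trans (cong (charEntry Xp L q) jj) (trans (charEntry-offDiagonal Xp L q (suc q) q≢1+q) (cong₂ offDiagonalEntry cellAt-q cellAt-suc-q))))) ⟩
          charEntry Xp L (suc q) j' +ₚ charEntry Xp L q j' ∎
        where
        jj : j' ≡ suc q
        jj = PunchedAt-functional hj punchedAt-q
      f (inj₂ j≢q) = begin
          charEntry Xp L' q j ≈⟨ ≡⇒≈ (trans (charEntry-offDiagonal Xp L' q j (j≢q ∘ sym)) (cong (λ z → offDiagonalEntry z (cellAt L' j)) cellAt′-q)) ⟩
          offDiagonalEntry e12 (cellAt L' j) ≈⟨ const-cong (trans (cong (λ z → - ((w1 ℤ.+ w2) ℤ.* adjL ℓ2 z)) (label-merged j j' hj))
                                  (trans (neg-distrib-weight w1 w2 (adjL ℓ2 (label (cellAt L j')))) (cong (λ z → (- (w2 ℤ.* adjL ℓ2 (label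
                                      (cellAt L j')))) ℤ.+ (- (w1 ℤ.* z))) (sym tj)))) ⟩
          offDiagonalEntry e2 (cellAt L j') +ₚ offDiagonalEntry e1 (cellAt L j')
            ≈⟨ ≡⇒≈ (sym (cong₂ _+ₚ_ (trans (charEntry-offDiagonal Xp L (suc q) j' (j'≢q1 ∘ sym)) (cong (λ z → offDiagonalEntry z (cellAt L j')) cellAt-suc-q))
                                    (trans (charEntry-offDiagonal Xp L q j' (j'≢q ∘ sym)) (cong (λ z → offDiagonalEntry z (cellAt L j')) cellAt-q)))) ⟩
          charEntry Xp L (suc q) j' +ₚ charEntry Xp L q j' ∎
        where
        j'≢q : j' ≢ q
        j'≢q = g hj
          where
          g : PunchedAt q j j' → j' ≢ q
          g (inj₁ (lt' , e)) x = j≢q (trans (sym e) x)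
          g (inj₂ (ge , e)) x = ℕP.<-irrefl refl (ℕP.≤-trans (s≤s ge) (ℕP.≤-reflexive (trans (sym e) x)))
        j'≢q1 : j' ≢ suc q
        j'≢q1 x = j≢q (PunchedAt-injective hj punchedAt-q x)
        tj : adjL ℓ1 (label (cellAt L j')) ≡ adjL ℓ2 (label (cellAt L j'))
        tj = proj₂ (tw j' (subst (j' <_) (sym lenL) lt) j'≢q j'≢q1)

    ltp : q < suc (suc n)
    ltp = s≤s (ℕP.≤-trans (ℕP.m≤m+n q _) (ℕP.n≤1+n _))
    ltp1 : suc q < suc (suc n)
    ltp1 = s≤s (s≤s (ℕP.m≤m+n q _))
    ltp' : q < suc n
    ltp' = s≤s (ℕP.m≤m+n q _)
    p p1 : Fin (suc (suc n))
    p = Fin.fromℕ< ltp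
    p1 = Fin.fromℕ< ltp1
    p' : Fin (suc n)
    p' = Fin.fromℕ< ltp'
    tp : toℕ p ≡ q
    tp = toℕ-fromℕ< ltp
    tp1 : toℕ p1 ≡ suc q
    tp1 = toℕ-fromℕ< ltp1
    tp' : toℕ p' ≡ q
    tp' = toℕ-fromℕ< ltp'
    p≢p1 : p ≢ p1
    p≢p1 x = q≢1+q (trans (sym tp) (trans (cong toℕ x) tp1))

    M : PolyMatrix (suc (suc n))
    M = charMatrix Xp L (suc (suc n))
    Nc : Fin (suc (suc n)) → Poly
    Nc a = M a p +ₚ ⟨-1⟩ *ₚ M a p1
    N N2 N3 : PolyMatrix (suc (suc n))
    N = replaceColumn M p Nc
    N2 = replaceColumn M p (λ a → unitColumn q (toℕ a))
    N3 = replaceColumn M p (λ a → unitColumn (suc q) (toℕ a))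
    A B : PolyMatrix (suc n)
    A = minor p p M
    B = minor p1 p M
    R : PolyMatrix (suc n)
    R = charMatrix Xp L' (suc n)

    det-subtractTwinColumn : det (suc (suc n)) N ≈ det (suc (suc n)) M
    det-subtractTwinColumn = det-addColumnMultiple (suc (suc n)) M N p p1 ⟨-1⟩ p≢p1 (λ a → ≡⇒≈ (atColumn-≡ p (Nc a) (M a p)))
      (λ a b ne → ≡⇒≈ (atColumn-≢ p b (Nc a) (M a b) ne))

    det-splitColumn : det (suc (suc n)) N ≈ r *ₚ det (suc (suc n)) N2 +ₚ s *ₚ det (suc (suc n)) N3
    det-splitColumn = det-linearColumn (suc (suc n)) N2 N N3 p r s hcol
      (λ a b ne → ≡⇒≈ (trans (atColumn-≢ p b (Nc a) (M a b) ne) (sym (atColumn-≢ p b (unitColumn q (toℕ a)) (M a b) ne))))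
      (λ a b ne → ≡⇒≈ (trans (atColumn-≢ p b (Nc a) (M a b) ne) (sym (atColumn-≢ p b (unitColumn (suc q) (toℕ a)) (M a b) ne))))
      where
      hcol : ∀ a → N a p ≈ r *ₚ N2 a p +ₚ s *ₚ N3 a p
      hcol a = ≈trans (≡⇒≈ (trans (atColumn-≡ p (Nc a) (M a p)) (cong₂ (λ u v → charEntry Xp L (toℕ a) u +ₚ ⟨-1⟩ *ₚ charEntry Xp L (toℕ a) v) tp tp1)))
        (≈trans (columnDifference (toℕ a) (toℕ<n a))
        (≡⇒≈ (sym (cong₂ (λ u v → r *ₚ u +ₚ s *ₚ v) (atColumn-≡ p (unitColumn q (toℕ a)) (M a p)) (atColumn-≡ p (unitColumn (suc q) (toℕ a)) (M a p))))))

    toℕ-≢ᵢ : ∀ {m} (a c : Fin m) i → toℕ c ≡ i → a ≢ c → toℕ a ≢ i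
    toℕ-≢ᵢ a c i e ne x = ne (toℕ-injective (trans x (sym e)))

    det-unitColumn-q : det (suc (suc n)) N2 ≈ + 1 ·ₚ (1ₚ *ₚ det (suc n) A)
    det-unitColumn-q = ≈trans (det-singleEntryColumn (suc n) N2 p p (λ a ne → ≡⇒≈ (trans (atColumn-≡ p (unitColumn q (toℕ a)) (M a p)) (unitColumn-≢ q
        (toℕ a) (toℕ-≢ᵢ a p q tp ne)))))
      (≈trans (≡⇒≈ (cong₂ (λ u v → sign u ·ₚ (v *ₚ det (suc n) (minor p p N2)))
                   (trans (cong₂ _+_ tp tp) refl) (trans (atColumn-≡ p (unitColumn q (toℕ p)) (M p p)) (trans (cong (unitColumn q) tp) (unitColumn-≡ q)))))
      (≈trans (·-congˡ (1ₚ *ₚ det (suc n) (minor p p N2)) (sign-double q))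
      (·-cong (+ 1) (*-congʳ 1ₚ (det-cong (suc n) (λ a b → ≡⇒≈ (atColumn-≢ p (punchIn p b) (unitColumn q (toℕ (punchIn p a))) (M (punchIn p a)
          (punchIn p b)) (punchInᵢ≢i p b))))))))

    det-unitColumn-suc-q : det (suc (suc n)) N3 ≈ (- (+ 1)) ·ₚ (1ₚ *ₚ det (suc n) B)
    det-unitColumn-suc-q = ≈trans (det-singleEntryColumn (suc n) N3 p1 p (λ a ne → ≡⇒≈ (trans (atColumn-≡ p (unitColumn (suc q) (toℕ a)) (M a p))
        (unitColumn-≢ (suc q) (toℕ a) (toℕ-≢ᵢ a p1 (suc q) tp1 ne)))))
      (≈trans (≡⇒≈ (cong₂ (λ u v → sign u ·ₚ (v *ₚ det (suc n) (minor p1 p N3)))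
                   (cong₂ _+_ tp1 tp) (trans (atColumn-≡ p (unitColumn (suc q) (toℕ p1)) (M p1 p)) (trans (cong (unitColumn (suc q)) tp1) (unitColumn-≡ (suc q))))))
      (≈trans (·-congˡ (1ₚ *ₚ det (suc n) (minor p1 p N3)) (trans (sign-suc (q + q)) (cong -_ (sign-double q))))
      (·-cong (- (+ 1)) (*-congʳ 1ₚ (det-cong (suc n) (λ a b → ≡⇒≈ (atColumn-≢ p (punchIn p b) (unitColumn (suc q) (toℕ (punchIn p1 a))) (M
          (punchIn p1 a) (punchIn p b)) (punchInᵢ≢i p b))))))))

    punchedAt-q-punchIn : ∀ {m} (c : Fin (suc m)) (b : Fin m) → toℕ c ≡ q → PunchedAt q (toℕ b) (toℕ (punchIn c b))
    punchedAt-q-punchIn c b e = subst (λ z → PunchedAt z (toℕ b) (toℕ (punchIn c b))) e (PunchedAt-punchIn c b)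

    tpp' : toℕ (punchIn p p') ≡ suc q
    tpp' = PunchedAt-functional (subst (λ z → PunchedAt q z (toℕ (punchIn p p'))) tp' (punchedAt-q-punchIn p p' tp)) punchedAt-q

    tp1p' : toℕ (punchIn p1 p') ≡ q
    tp1p' with toℕ-punchIn p1 p'
    ... | inj₁ (_ , e) = trans e tp'
    ... | inj₂ (ge , _) = ⊥-elim (ℕP.<-irrefl refl (ℕP.≤-trans (ℕP.≤-reflexive (sym tp1)) (ℕP.≤-trans ge (ℕP.≤-reflexive tp'))))

    det-addRows : det (suc n) R ≈ det (suc n) A +ₚ det (suc n) B
    det-addRows = det-additiveRow (suc n) A R B p' hr hA hB
      where
      hr : ∀ b → R p' b ≈ A p' b +ₚ B p' b
      hr b = ≈trans (≡⇒≈ (cong (λ z → charEntry Xp L' z (toℕ b)) tp'))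
        (≈trans (charEntry-mergedRow (toℕ b) (toℕ (punchIn p b)) (punchedAt-q-punchIn p b tp) (toℕ<n (punchIn p b)))
        (≡⇒≈ (sym (cong₂ (λ u v → charEntry Xp L u (toℕ (punchIn p b)) +ₚ charEntry Xp L v (toℕ (punchIn p b))) tpp' tp1p'))))
      hA : ∀ a b → a ≢ p' → R a b ≈ A a b
      hA a b ne = ≡⇒≈ (charEntry-merged (toℕ a) (toℕ (punchIn p a)) (toℕ b) (toℕ (punchIn p b)) (toℕ-≢ᵢ a p' q tp' ne) (punchedAt-q-punchIn p a tp)
          (punchedAt-q-punchIn p b tp))
      hB : ∀ a b → a ≢ p' → R a b ≈ B a b
      hB a b ne = ≡⇒≈ (charEntry-merged (toℕ a) (toℕ (punchIn p1 a)) (toℕ b) (toℕ (punchIn p b)) (toℕ-≢ᵢ a p' q tp' ne)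
          (PunchedAt-punchIn-pred p1 a q tp1 (toℕ-≢ᵢ a p' q tp' ne)) (punchedAt-q-punchIn p b tp))

    charDet-merged : charDet Xp L ≈ r *ₚ charDet Xp L'
    charDet-merged = begin
      charDet Xp L ≈⟨ ≡⇒≈ (charDet-length Xp L (suc (suc n)) lenL) ⟩
      det (suc (suc n)) M ≈⟨ ≈sym det-subtractTwinColumn ⟩
      det (suc (suc n)) N ≈⟨ det-splitColumn ⟩
      r *ₚ det (suc (suc n)) N2 +ₚ s *ₚ det (suc (suc n)) N3 ≈⟨ +-cong (*-congʳ r det-unitColumn-q) (*-congʳ s det-unitColumn-suc-q) ⟩
      r *ₚ (+ 1 ·ₚ (1ₚ *ₚ det (suc n) A)) +ₚ (r *ₚ ⟨-1⟩) *ₚ ((- (+ 1)) ·ₚ (1ₚ *ₚ det (suc n) B)) ≈⟨ combineMinors r (det (suc n) A) (det (suc n) B) ⟩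
      r *ₚ (det (suc n) A +ₚ det (suc n) B) ≈⟨ *-congʳ r (≈sym det-addRows) ⟩
      r *ₚ det (suc n) R ≈⟨ ≡⇒≈ (cong (r *ₚ_) (sym (charDet-length Xp L' (suc n) lenL'))) ⟩
      r *ₚ charDet Xp L' ∎

  charDet-mergeTwins : ∀ Xp (P Suf : List Cellₖ) ℓ1 ℓ2 w1 w2 d1 d2 ε
    → adjL ℓ1 ℓ2 ≡ ε → adjL ℓ2 ℓ1 ≡ ε → d1 ℤ.+ ε ≡ ε ℤ.* w1 → d2 ℤ.+ ε ≡ ε ℤ.* w2
    → (∀ i → i < length (P ++ cell ℓ1 w1 d1 ∷ cell ℓ2 w2 d2 ∷ Suf) → i ≢ length P → i ≢ suc (length P)
          → Twins ℓ1 ℓ2 (cellAt (P ++ cell ℓ1 w1 d1 ∷ cell ℓ2 w2 d2 ∷ Suf) i))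
    → charDet Xp (P ++ cell ℓ1 w1 d1 ∷ cell ℓ2 w2 d2 ∷ Suf) ≈ (Xp +ₚ (ε ∷ [])) *ₚ charDet Xp (P ++ cell ℓ2 (w1 ℤ.+ w2) (d2 ℤ.+ ε ℤ.* w1) ∷ Suf)
  charDet-mergeTwins Xp P Suf ℓ1 ℓ2 w1 w2 d1 d2 ε h12 h21 hd1 hd2 tw = MergeTwins.charDet-merged Xp P Suf ℓ1 ℓ2 w1 w2 d1 d2 ε h12 h21 hd1 hd2 tw

  unitCell : Label (suc k) → Cellₖ
  unitCell ℓ = cell ℓ (+ 1) (+ 0)

  charDet-mergeBlock : ∀ Xp (P Suf : List Cellₖ) ℓ ε → adjL ℓ ℓ ≡ ε → ∀ s w d → d ℤ.+ ε ≡ ε ℤ.* w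
    → charDet Xp (P ++ cell ℓ w d ∷ replicate s (unitCell ℓ) ++ Suf) ≈ ((Xp +ₚ (ε ∷ [])) ^ₚ s) *ₚ charDet Xp (P ++ cell ℓ (w ℤ.+ + s) (d ℤ.+ ε ℤ.* + s) ∷ Suf)
  charDet-mergeBlock Xp P Suf ℓ ε h zero w d hd =
    ≈sym (≈trans (*-identityˡ _) (≡⇒≈ (cong₂ (λ a b → charDet Xp (P ++ cell ℓ a b ∷ Suf)) (ℤP.+-identityʳ w)
      (trans (cong (λ z → d ℤ.+ z) (ℤP.*-zeroʳ ε)) (ℤP.+-identityʳ d)))))
  charDet-mergeBlock Xp P Suf ℓ ε h (suc s) w d hd = begin
    charDet Xp (P ++ cell ℓ w d ∷ unitCell ℓ ∷ replicate s (unitCell ℓ) ++ Suf)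
      ≈⟨ charDet-mergeTwins Xp P (replicate s (unitCell ℓ) ++ Suf) ℓ ℓ w (+ 1) d (+ 0) ε h h hd (arith₁ ε) (λ i _ _ _ → refl , refl) ⟩
    r *ₚ charDet Xp (P ++ cell ℓ (w ℤ.+ + 1) (+ 0 ℤ.+ ε ℤ.* w) ∷ replicate s (unitCell ℓ) ++ Suf)
      ≈⟨ *-congʳ r (charDet-mergeBlock Xp P Suf ℓ ε h s (w ℤ.+ + 1) (+ 0 ℤ.+ ε ℤ.* w) (arith₂ ε w)) ⟩
    r *ₚ ((r ^ₚ s) *ₚ charDet Xp (P ++ cell ℓ (w ℤ.+ + 1 ℤ.+ + s) (+ 0 ℤ.+ ε ℤ.* w ℤ.+ ε ℤ.* + s) ∷ Suf))
      ≈⟨ ≈sym (*-assoc r (r ^ₚ s) _) ⟩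
    (r ^ₚ suc s) *ₚ charDet Xp (P ++ cell ℓ (w ℤ.+ + 1 ℤ.+ + s) (+ 0 ℤ.+ ε ℤ.* w ℤ.+ ε ℤ.* + s) ∷ Suf)
      ≈⟨ ≡⇒≈ (cong (λ z → (r ^ₚ suc s) *ₚ z) (cong₂ (λ a b → charDet Xp (P ++ cell ℓ a b ∷ Suf)) ew ed)) ⟩
    (r ^ₚ suc s) *ₚ charDet Xp (P ++ cell ℓ (w ℤ.+ + suc s) (d ℤ.+ ε ℤ.* + suc s) ∷ Suf) ∎
    where
    r = Xp +ₚ (ε ∷ [])
    arith₁ : ∀ e → + 0 ℤ.+ e ≡ e ℤ.* + 1
    arith₁ = solveℤ
    arith₂ : ∀ e w → + 0 ℤ.+ e ℤ.* w ℤ.+ e ≡ e ℤ.* (w ℤ.+ + 1)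
    arith₂ = solveℤ
    ew : w ℤ.+ + 1 ℤ.+ + s ≡ w ℤ.+ + suc s
    ew = trans (ℤP.+-assoc w (+ 1) (+ s)) (cong (λ z → w ℤ.+ z) (sym (ℤP.pos-+ 1 s)))
    arith₃ : ∀ e w d s → d ℤ.+ e ≡ e ℤ.* w → + 0 ℤ.+ e ℤ.* w ℤ.+ e ℤ.* s ≡ d ℤ.+ e ℤ.* (+ 1 ℤ.+ s)
    arith₃ e w d s x = trans (cong (λ z → + 0 ℤ.+ z ℤ.+ e ℤ.* s) (sym x)) (arith₄ e d s)
      where
      arith₄ : ∀ e d s → + 0 ℤ.+ (d ℤ.+ e) ℤ.+ e ℤ.* s ≡ d ℤ.+ e ℤ.* (+ 1 ℤ.+ s)
      arith₄ = solveℤ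
    ed : + 0 ℤ.+ ε ℤ.* w ℤ.+ ε ℤ.* + s ≡ d ℤ.+ ε ℤ.* + suc s
    ed = trans (arith₃ ε w d (+ s) hd) (cong (λ z → d ℤ.+ ε ℤ.* z) (sym (ℤP.pos-+ 1 s)))

  Block : Set
  Block = Label (suc k) × ℕ

  expandBlocks : List Block → List Cellₖ
  expandBlocks [] = []
  expandBlocks ((ℓ , t) ∷ B) = unitCell ℓ ∷ replicate t (unitCell ℓ) ++ expandBlocks B

  blockCell : Block → Cellₖ
  blockCell (ℓ , t) = cell ℓ (+ 1 ℤ.+ + t) (+ 0 ℤ.+ adjL ℓ ℓ ℤ.* + t)

  blockFactor : Poly → List Block → Poly
  blockFactor Xp [] = 1ₚ
  blockFactor Xp ((ℓ , t) ∷ B) = ((Xp +ₚ (adjL ℓ ℓ ∷ [])) ^ₚ t) *ₚ blockFactor Xp B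

  charDet-expandBlocks : ∀ Xp (P : List Cellₖ) B → charDet Xp (P ++ expandBlocks B) ≈ blockFactor Xp B *ₚ charDet Xp (P ++ map blockCell B)
  charDet-expandBlocks Xp P [] = ≈sym (*-identityˡ _)
  charDet-expandBlocks Xp P ((ℓ , t) ∷ B) = begin
    charDet Xp (P ++ unitCell ℓ ∷ replicate t (unitCell ℓ) ++ expandBlocks B)
      ≈⟨ charDet-mergeBlock Xp P (expandBlocks B) ℓ (adjL ℓ ℓ) refl t (+ 1) (+ 0) (arith (adjL ℓ ℓ)) ⟩
    (r ^ₚ t) *ₚ charDet Xp (P ++ blockCell (ℓ , t) ∷ expandBlocks B)
      ≈⟨ *-congʳ (r ^ₚ t) (≡⇒≈ (cong (charDet Xp) (sym (LP.++-assoc P (blockCell (ℓ , t) ∷ []) (expandBlocks B))))) ⟩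
    (r ^ₚ t) *ₚ charDet Xp ((P ++ blockCell (ℓ , t) ∷ []) ++ expandBlocks B)
      ≈⟨ *-congʳ (r ^ₚ t) (charDet-expandBlocks Xp (P ++ blockCell (ℓ , t) ∷ []) B) ⟩
    (r ^ₚ t) *ₚ (blockFactor Xp B *ₚ charDet Xp ((P ++ blockCell (ℓ , t) ∷ []) ++ map blockCell B))
      ≈⟨ ≈sym (*-assoc (r ^ₚ t) (blockFactor Xp B) _) ⟩
    ((r ^ₚ t) *ₚ blockFactor Xp B) *ₚ charDet Xp ((P ++ blockCell (ℓ , t) ∷ []) ++ map blockCell B)
      ≈⟨ *-congʳ ((r ^ₚ t) *ₚ blockFactor Xp B) (≡⇒≈ (cong (charDet Xp) (LP.++-assoc P (blockCell (ℓ , t) ∷ []) (map blockCell B)))) ⟩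
    ((r ^ₚ t) *ₚ blockFactor Xp B) *ₚ charDet Xp (P ++ blockCell (ℓ , t) ∷ map blockCell B) ∎
    where
    r = Xp +ₚ (adjL ℓ ℓ ∷ [])
    arith : ∀ e → + 0 ℤ.+ e ≡ e ℤ.* + 1
    arith = solveℤ

  cellIndex : Label (suc k) → Fin (suc k)
  cellIndex (uL i) = i
  cellIndex (vL i) = i

  After : Fin (suc k) → Label (suc k) → Set
  After i ℓ = toℕ i < toℕ (cellIndex ℓ)

  AllAfter : Fin (suc k) → List Cellₖ → Set
  AllAfter i T = ∀ j → j < length T → After i (label (cellAt T j))

  adjL-u-after : ∀ i ℓ → After i ℓ → adjL (uL i) ℓ ≡ + 0
  adjL-u-after i (uL j) _ = refl
  adjL-u-after i (vL j) lt rewrite >⇒≤ᵇ≡false lt = refl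
  adjL-after-u : ∀ i ℓ → After i ℓ → adjL ℓ (uL i) ≡ + 0
  adjL-after-u i (uL j) _ = refl
  adjL-after-u i (vL j) lt rewrite >⇒≤ᵇ≡false lt = refl
  adjL-after-v : ∀ i ℓ → After i ℓ → adjL ℓ (vL i) ≡ + 1
  adjL-after-v i (uL j) lt rewrite ≤⇒≤ᵇ≡true (ℕP.<⇒≤ lt) = refl
  adjL-after-v i (vL j) _ = refl
  adjL-u-v : ∀ (i : Fin (suc k)) → adjL (uL i) (vL i) ≡ + 1
  adjL-u-v i rewrite ≤⇒≤ᵇ≡true (ℕP.≤-refl {toℕ i}) = refl
  adjL-v-u : ∀ (i : Fin (suc k)) → adjL (vL i) (uL i) ≡ + 1
  adjL-v-u i rewrite ≤⇒≤ᵇ≡true (ℕP.≤-refl {toℕ i}) = refl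

  IfLast : (ℤ → Set) → List Cellₖ → ℤ → Set
  IfLast Q [] mw = Q mw
  IfLast Q (_ ∷ _) mw = ⊤

  -- The shape of the fully merged cell list: pairs u_i v_i with increasing i, loops 0
  -- and n_i − 1, optionally ending in a single v cell (u_h and v_h merged).
  -- Q constrains the weight of the last u cell.
  data Reduced (Q : ℤ → Set) : List Cellₖ → Set where
    done : Reduced Q []
    lone : ∀ j w d → d ℤ.+ + 1 ≡ w → ¬ (w ≡ + 0) → ¬ (d ≡ + 0) → Reduced Q (cell (vL j) w d ∷ [])
    pair : ∀ i mw md nw nd T → md ≡ + 0 → nd ℤ.+ + 1 ≡ nw → ¬ (mw ≡ + 0) → ¬ (nw ≡ + 0)
      → IfLast Q T mw → AllAfter i T → Reduced Q T → Reduced Q (cell (uL i) mw md ∷ cell (vL i) nw nd ∷ T)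

  charEntry-suc : ∀ Xp e L i j → charEntry Xp (e ∷ L) (suc i) (suc j) ≡ charEntry Xp L i j
  charEntry-suc Xp e L i j with ≡⊎≢ i j
  ... | inj₁ refl = trans (charEntry-diagonal Xp (e ∷ L) (suc i)) (sym (charEntry-diagonal Xp L i))
  ... | inj₂ ne = trans (charEntry-offDiagonal Xp (e ∷ L) (suc i) (suc j) (ne ∘ ℕP.suc-injective)) (sym (charEntry-offDiagonal Xp L i j ne))

  nonRoot0-reduced : ∀ {Q} L → Reduced Q L → NonRootAt (+ 0) (charDet ⟨0⟩ L)
  nonRoot0-reduced [] done = NonRootAt-1
  nonRoot0-reduced (cell (vL j) w d ∷ []) (lone j w d hd hw hd0) =
    NonRootAt-≈ (det-1 (charMatrix ⟨0⟩ (cell (vL j) w d ∷ []) 1)) (NonRootAt-const _ (λ e → hd0 (trans (sym (ℤP.neg-involutive d)) (cong -_ (trans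
        (sym (ℤP.+-identityʳ (- d))) e)))))
  nonRoot0-reduced (cell (uL i) mw md ∷ cell (vL i) nw nd ∷ T) (pair i mw md nw nd T hmd hnd hm hn eq al gT) =
    NonRootAt-≈ s1 (NonRootAt-· (sign≢0 1) (NonRootAt-* (NonRootAt-const _ (subst (λ z → ¬ (- (mw ℤ.* z) ≡ + 0)) (sym (adjL-u-v i)) (-*1≢0 hm)))
      (NonRootAt-≈ s2 (NonRootAt-· (sign≢0 0) (NonRootAt-* (NonRootAt-const _ (subst (λ z → ¬ (- (nw ℤ.* z) ≡ + 0)) (sym (adjL-v-u i)) (-*1≢0 hn)))
        (NonRootAt-≈ (det-cong n (λ a b → ≡⇒≈ (trans (charEntry-suc ⟨0⟩ _ _ (suc (toℕ a)) (suc (toℕ b))) (charEntry-suc ⟨0⟩ _ _ (toℕ a) (toℕ b)))))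
            (nonRoot0-reduced T gT)))))))
    where
    L = cell (uL i) mw md ∷ cell (vL i) nw nd ∷ T
    n = length T
    M : PolyMatrix (suc (suc n))
    M = charMatrix ⟨0⟩ L (suc (suc n))
    h1 : ∀ b → b ≢ fs fz → M fz b ≈ []
    h1 fz _ = const≈[] (trans (cong (λ z → (- z) ℤ.+ + 0) hmd) refl)
    h1 (fs fz) ne = ⊥-elim (ne refl)
    h1 (fs (fs b)) _ = const≈[] (trans (cong (λ z → - (mw ℤ.* z)) (adjL-u-after i (label (cellAt T (toℕ b))) (al (toℕ b) (toℕ<n b)))) (cong -_ (ℤP.*-zeroʳ mw)))
    s1 = det-singleEntryFirstRow (suc n) M (fs fz) h1
    K : PolyMatrix (suc n)
    K = minor fz (fs fz) M
    h2 : ∀ a → a ≢ fz → K a fz ≈ []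
    h2 fz ne = ⊥-elim (ne refl)
    h2 (fs a) _ = const≈[] (trans (cong (λ z → - (weight (cellAt T (toℕ a)) ℤ.* z)) (adjL-after-u i (label (cellAt T (toℕ a))) (al (toℕ a)
        (toℕ<n a)))) (cong -_ (ℤP.*-zeroʳ (weight (cellAt T (toℕ a))))))
    s2 = det-singleEntryColumn n K fz fz h2

  -- At x = −1 the pivot of the last pair is n_h (m_h − 1).
  NotOne : ℤ → Set
  NotOne mw = ¬ (mw ≡ + 1)

  laterRow-vanishes : ∀ mw w A1 A0 A2 → A1 ≡ + 1 → A0 ≡ + 0 → A2 ≡ + 1
    → ((- (w ℤ.* A1)) ℤ.+ ((- mw) ℤ.* (- (w ℤ.* A0)) ℤ.+ + 0)) ℤ.+ ((- (+ 1)) ℤ.* (- (w ℤ.* A2)) ℤ.+ + 0) ≡ + 0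
  laterRow-vanishes mw w _ _ _ refl refl refl = arith mw w
    where
    arith : ∀ mw w → ((- (w ℤ.* + 1)) ℤ.+ ((- mw) ℤ.* (- (w ℤ.* + 0)) ℤ.+ + 0)) ℤ.+ ((- (+ 1)) ℤ.* (- (w ℤ.* + 1)) ℤ.+ + 0) ≡ + 0
    arith = solveℤ

  laterVRow-vanishes : ∀ mw w d B0 → B0 ≡ + 0 → d ℤ.+ + 1 ≡ w
    → ((- (w ℤ.* + 1)) ℤ.+ ((- mw) ℤ.* (- (w ℤ.* B0)) ℤ.+ + 0)) ℤ.+ ((- (+ 1)) ℤ.* ((- d) ℤ.+ (- (+ 1))) ℤ.+ + 0) ≡ + 0
  laterVRow-vanishes mw w d _ refl refl = arith mw d
    where
    arith : ∀ mw d → ((- ((d ℤ.+ + 1) ℤ.* + 1)) ℤ.+ ((- mw) ℤ.* (- ((d ℤ.+ + 1) ℤ.* + 0)) ℤ.+ + 0)) ℤ.+ ((- (+ 1)) ℤ.* ((- d) ℤ.+ (- (+ 1))) ℤ.+ + 0) ≡ + 0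
    arith = solveℤ

  pivot≡nw*mw : ∀ mw nw nd A A' → A ≡ + 1 → A' ≡ + 1 → nd ℤ.+ + 1 ≡ nw
    → (((- nd) ℤ.+ (- (+ 1))) ℤ.+ ((- mw) ℤ.* (- (nw ℤ.* A)) ℤ.+ + 0)) ℤ.+ ((- (+ 1)) ℤ.* (- (nw ℤ.* A')) ℤ.+ + 0) ≡ nw ℤ.* mw
  pivot≡nw*mw mw nw nd _ _ refl refl refl = arith mw nd
    where
    arith : ∀ mw nd → (((- nd) ℤ.+ (- (+ 1))) ℤ.+ ((- mw) ℤ.* (- ((nd ℤ.+ + 1) ℤ.* + 1)) ℤ.+ + 0)) ℤ.+ ((- (+ 1)) ℤ.* (-
        ((nd ℤ.+ + 1) ℤ.* + 1)) ℤ.+ + 0) ≡ (nd ℤ.+ + 1) ℤ.* mw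
    arith = solveℤ

  lastPivot≡nw*[mw-1] : ∀ mw nw nd A → A ≡ + 1 → nd ℤ.+ + 1 ≡ nw
    → ((- nd) ℤ.+ (- (+ 1))) ℤ.+ ((- mw) ℤ.* (- (nw ℤ.* A)) ℤ.+ + 0) ≡ nw ℤ.* (mw ℤ.+ (- (+ 1)))
  lastPivot≡nw*[mw-1] mw nw nd _ refl refl = arith mw nd
    where
    arith : ∀ mw nd → ((- nd) ℤ.+ (- (+ 1))) ℤ.+ ((- mw) ℤ.* (- ((nd ℤ.+ + 1) ℤ.* + 1)) ℤ.+ + 0) ≡ (nd ℤ.+ + 1) ℤ.* (mw ℤ.+ (- (+ 1)))
    arith = solveℤ

  pivotRow-vanishes : ∀ mw md A → A ≡ + 1 → md ≡ + 0
    → (- (mw ℤ.* A)) ℤ.+ ((- mw) ℤ.* ((- md) ℤ.+ (- (+ 1))) ℤ.+ + 0) ≡ + 0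
  pivotRow-vanishes mw _ _ refl refl = arith mw
    where
    arith : ∀ mw → (- (mw ℤ.* + 1)) ℤ.+ ((- mw) ℤ.* ((- (+ 0)) ℤ.+ (- (+ 1))) ℤ.+ + 0) ≡ + 0
    arith = solveℤ

  nonRoot-eliminateColumn : ∀ n (K : PolyMatrix (suc n)) (c2 : Fin (suc n)) (T : List Cellₖ) → length T ≡ n → c2 ≢ fz
    → (∀ a → a ≢ fz → K a fz +ₚ ⟨-1⟩ *ₚ K a c2 ≈ [])
    → NonRootAt (- (+ 1)) (K fz fz +ₚ ⟨-1⟩ *ₚ K fz c2)
    → (∀ a b → K (fs a) (fs b) ≡ charMatrix ⟨-1⟩ T n a b)
    → NonRootAt (- (+ 1)) (charDet ⟨-1⟩ T) → NonRootAt (- (+ 1)) (det (suc n) K)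
  nonRoot-eliminateColumn n K c2 T refl c2≢0 hz h00 hm IH =
    NonRootAt-≈ (≈sym cop) (NonRootAt-≈ uc (NonRootAt-· (sign≢0 0) (NonRootAt-* (NonRootAt-≈ (≡⇒≈ (atColumn-≡ {suc n} fz (Kc fz) (K fz fz))) h00)
      (NonRootAt-≈ (det-cong n (λ a b → ≡⇒≈ (trans (atColumn-≢ {suc n} fz (fs b) (Kc (fs a)) (K (fs a) (fs b)) (λ ())) (hm a b)))) IH))))
    where
    Kc : Fin (suc n) → Poly
    Kc a = K a fz +ₚ ⟨-1⟩ *ₚ K a c2
    K' = replaceColumn K fz Kc
    cop : det (suc n) K' ≈ det (suc n) K
    cop = det-addColumnMultiple (suc n) K K' fz c2 ⟨-1⟩ (c2≢0 ∘ sym) (λ a → ≡⇒≈ (atColumn-≡ {suc n} fz (Kc a) (K a fz))) (λ a b ne → ≡⇒≈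
        (atColumn-≢ {suc n} fz b (Kc a) (K a b) ne))
    uc = det-singleEntryColumn n K' fz fz (λ a ne → ≈trans (≡⇒≈ (atColumn-≡ {suc n} fz (Kc a) (K a fz))) (hz a ne))

  module EliminatePair (i : Fin (suc k)) (mw md nw nd : ℤ) (T : List Cellₖ) where
    L : List Cellₖ
    L = cell (uL i) mw md ∷ cell (vL i) nw nd ∷ T
    n : ℕ
    n = length T
    M : PolyMatrix (suc (suc n))
    M = charMatrix ⟨-1⟩ L (suc (suc n))
    r : Poly
    r = (- mw) ∷ []
    Nc : Fin (suc (suc n)) → Poly
    Nc a = M a (fs fz) +ₚ r *ₚ M a fz
    N : PolyMatrix (suc (suc n))
    N = replaceColumn M (fs fz) Nc
    K : PolyMatrix (suc n)
    K = minor fz fz N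
    Kfz : ∀ a → K a fz ≡ Nc (fs a)
    Kfz a = atColumn-≡ {suc (suc n)} (fs fz) (Nc (fs a)) (M (fs a) (fs fz))
    Kfs : ∀ a b → K a (fs b) ≡ M (fs a) (fs (fs b))
    Kfs a b = atColumn-≢ {suc (suc n)} (fs fz) (fs (fs b)) (Nc (fs a)) (M (fs a) (fs (fs b))) (λ ())
    Kmin : ∀ a b → K (fs a) (fs b) ≡ charMatrix ⟨-1⟩ T n a b
    Kmin a b = trans (Kfs (fs a) b) (trans (charEntry-suc ⟨-1⟩ _ _ (suc (toℕ a)) (suc (toℕ b))) (charEntry-suc ⟨-1⟩ _ _ (toℕ a) (toℕ b)))

    nonRoot-eliminatePair : md ≡ + 0 → AllAfter i T → NonRootAt (- (+ 1)) (det (suc n) K) → NonRootAt (- (+ 1)) (charDet ⟨-1⟩ L)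
    nonRoot-eliminatePair hmd al nk = NonRootAt-≈ (≈sym sA) (NonRootAt-≈ sB (NonRootAt-· (sign≢0 0) (NonRootAt-* n00 nk)))
      where
      sA : det (suc (suc n)) N ≈ det (suc (suc n)) M
      sA = det-addColumnMultiple (suc (suc n)) M N (fs fz) fz r (λ ()) (λ a → ≡⇒≈ (atColumn-≡ {suc (suc n)} (fs fz) (Nc a) (M a (fs fz))))
        (λ a b ne → ≡⇒≈ (atColumn-≢ {suc (suc n)} (fs fz) b (Nc a) (M a b) ne))
      hB : ∀ b → b ≢ fz → N fz b ≈ []
      hB fz ne = ⊥-elim (ne refl)
      hB (fs fz) _ = ≈trans (≡⇒≈ (atColumn-≡ {suc (suc n)} (fs fz) (Nc fz) (M fz (fs fz)))) (const≈[] (pivotRow-vanishes mw md (adjL (uL i) (vL i)) (adjL-u-v i) hmd))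
      hB (fs (fs b)) _ = ≈trans (≡⇒≈ (atColumn-≢ {suc (suc n)} (fs fz) (fs (fs b)) (Nc fz) (M fz (fs (fs b))) (λ ())))
        (const≈[] (-*-zeroʳ mw (adjL (uL i) (label (cellAt T (toℕ b)))) (adjL-u-after i (label (cellAt T (toℕ b))) (al (toℕ b) (toℕ<n b)))))
      sB = det-singleEntryFirstRow (suc n) N fz hB
      n00 : NonRootAt (- (+ 1)) (N fz fz)
      n00 = NonRootAt-≈ (≡⇒≈ (atColumn-≢ {suc (suc n)} (fs fz) fz (Nc fz) (M fz fz) (λ ())))
        (NonRootAt-const _ (λ e → -0-1≢0 (trans (cong (λ z → (- z) ℤ.+ (- (+ 1))) (sym hmd)) e)))

  nonRoot-1-reduced : ∀ L → Reduced NotOne L → NonRootAt (- (+ 1)) (charDet ⟨-1⟩ L)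
  nonRoot-1-reduced [] done = NonRootAt-1
  nonRoot-1-reduced (cell (vL j) w d ∷ []) (lone j w d hd hw _) =
    NonRootAt-≈ (det-1 (charMatrix ⟨-1⟩ (cell (vL j) w d ∷ []) 1)) (NonRootAt-const _ (λ e → hw (trans (sym hd) (arith d e))))
    where
    arith : ∀ d → (- d) ℤ.+ (- (+ 1)) ≡ + 0 → d ℤ.+ + 1 ≡ + 0
    arith d e = trans (sym (ℤP.neg-involutive _)) (trans (cong -_ (trans (ℤP.neg-distrib-+ d (+ 1)) e)) refl)
  nonRoot-1-reduced (cell (uL i) mw md ∷ cell (vL i) nw nd ∷ []) (pair i mw md nw nd [] hmd hnd hm hn eq al done) =
    nonRoot-eliminatePair hmd al (NonRootAt-≈ (det-1 K) (NonRootAt-≈ (≡⇒≈ (Kfz fz)) (NonRootAt-const _ (λ e → *-≢0 hn (≢1⇒-1+≢0 eq) (trans (sym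
        (lastPivot≡nw*[mw-1] mw nw nd (adjL (vL i) (uL i)) (adjL-v-u i) hnd)) e)))))
    where open EliminatePair i mw md nw nd []
  nonRoot-1-reduced (cell (uL i) mw md ∷ cell (vL i) nw nd ∷ cell (vL j) w' d' ∷ []) (pair i mw md nw nd _ hmd hnd hm hn eq al (lone j w' d' hd' hw' hd0')) =
    nonRoot-eliminatePair hmd al (nonRoot-eliminateColumn 1 K (fs fz) T refl (λ ()) hz h00 Kmin (nonRoot-1-reduced T (lone j w' d' hd' hw' hd0')))
    where
    T = cell (vL j) w' d' ∷ []
    open EliminatePair i mw md nw nd T
    hz : ∀ a → a ≢ fz → K a fz +ₚ ⟨-1⟩ *ₚ K a (fs fz) ≈ []
    hz fz ne = ⊥-elim (ne refl)
    hz (fs fz) _ = ≈trans (≡⇒≈ (cong₂ (λ u v → u +ₚ ⟨-1⟩ *ₚ v) (Kfz (fs fz)) (Kfs (fs fz) fz)))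
      (const≈[] (laterVRow-vanishes mw w' d' (adjL (vL j) (uL i)) (adjL-after-u i (vL j) (al 0 (s≤s z≤n))) hd'))
    h00 : NonRootAt (- (+ 1)) (K fz fz +ₚ ⟨-1⟩ *ₚ K fz (fs fz))
    h00 = NonRootAt-≈ (≡⇒≈ (cong₂ (λ u v → u +ₚ ⟨-1⟩ *ₚ v) (Kfz fz) (Kfs fz fz)))
      (NonRootAt-const _ (λ e → *-≢0 hn hm (trans (sym (pivot≡nw*mw mw nw nd (adjL (vL i) (uL i)) (+ 1) (adjL-v-u i) refl hnd)) e)))
  nonRoot-1-reduced (cell (uL i) mw md ∷ cell (vL i) nw nd ∷ cell (uL i') mw' md' ∷ cell (vL i') nw' nd' ∷ T')
         (pair i mw md nw nd _ hmd hnd hm hn eq al (pair i' mw' md' nw' nd' T' hmd' hnd' hm' hn' eq' al' gT')) =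
    nonRoot-eliminatePair hmd al (nonRoot-eliminateColumn (suc (suc (length T'))) K (fs (fs fz)) T refl (λ ()) hz h00 Kmin (nonRoot-1-reduced T
        (pair i' mw' md' nw' nd' T' hmd' hnd' hm' hn' eq' al' gT')))
    where
    T = cell (uL i') mw' md' ∷ cell (vL i') nw' nd' ∷ T'
    open EliminatePair i mw md nw nd T
    hz : ∀ a → a ≢ fz → K a fz +ₚ ⟨-1⟩ *ₚ K a (fs (fs fz)) ≈ []
    hz fz ne = ⊥-elim (ne refl)
    hz (fs fz) _ = ≈trans (≡⇒≈ (cong₂ (λ u v → u +ₚ ⟨-1⟩ *ₚ v) (Kfz (fs fz)) (Kfs (fs fz) (fs fz))))
      (const≈[] (laterRow-vanishes mw mw' (adjL (uL i') (vL i)) (+ 0) (adjL (uL i') (vL i')) (adjL-after-v i (uL i') (al 0 (s≤s z≤n))) refl (adjL-u-v i')))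
    hz (fs (fs fz)) _ = ≈trans (≡⇒≈ (cong₂ (λ u v → u +ₚ ⟨-1⟩ *ₚ v) (Kfz (fs (fs fz))) (Kfs (fs (fs fz)) (fs fz))))
      (const≈[] (laterVRow-vanishes mw nw' nd' (adjL (vL i') (uL i)) (adjL-after-u i (vL i') (al 1 (s≤s (s≤s z≤n)))) hnd'))
    hz (fs (fs (fs a))) _ = ≈trans (≡⇒≈ (cong₂ (λ u v → u +ₚ ⟨-1⟩ *ₚ v) (Kfz (fs (fs (fs a)))) (Kfs (fs (fs (fs a))) (fs fz))))
      (const≈[] (laterRow-vanishes mw (weight t) (adjL (label t) (vL i)) (adjL (label t) (uL i)) (adjL (label t) (vL i'))
        (adjL-after-v i (label t) (al (suc (suc (toℕ a))) (s≤s (s≤s (toℕ<n a)))))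
        (adjL-after-u i (label t) (al (suc (suc (toℕ a))) (s≤s (s≤s (toℕ<n a)))))
        (adjL-after-v i' (label t) (al' (toℕ a) (toℕ<n a)))))
      where
      t = cellAt T' (toℕ a)
    h00 : NonRootAt (- (+ 1)) (K fz fz +ₚ ⟨-1⟩ *ₚ K fz (fs (fs fz)))
    h00 = NonRootAt-≈ (≡⇒≈ (cong₂ (λ u v → u +ₚ ⟨-1⟩ *ₚ v) (Kfz fz) (Kfs fz (fs fz))))
      (NonRootAt-const _ (λ e → *-≢0 hn hm (trans (sym (pivot≡nw*mw mw nw nd (adjL (vL i) (uL i)) (+ 1) (adjL-v-u i) refl hnd)) e)))

  cellAt-++ˡ : ∀ (P X : List Cellₖ) i → i < length P → cellAt (P ++ X) i ≡ cellAt P i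
  cellAt-++ˡ (e ∷ P) X zero _ = refl
  cellAt-++ˡ (e ∷ P) X (suc i) (s≤s lt) = cellAt-++ˡ P X i lt

  eval-charEntry : ∀ L c i j → eval (charEntry Xₚ L i j) c ≡ eval (charEntry (c ∷ []) L i j) c
  eval-charEntry L c i j with ≡⊎≢ i j
  ... | inj₁ refl = trans (cong (λ z → eval z c) (charEntry-diagonal Xₚ L i)) (trans (trans (eval-+ ((- loop (cellAt L i)) ∷ []) Xₚ c) (trans (arith
      (- loop (cellAt L i)) c) (sym (eval-+ ((- loop (cellAt L i)) ∷ []) (c ∷ []) c))))
      (cong (λ z → eval z c) (sym (charEntry-diagonal (c ∷ []) L i))))
    where
    arith : ∀ a c → (a ℤ.+ c ℤ.* + 0) ℤ.+ (+ 0 ℤ.+ c ℤ.* (+ 1 ℤ.+ c ℤ.* + 0)) ≡ (a ℤ.+ c ℤ.* + 0) ℤ.+ (c ℤ.+ c ℤ.* + 0)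
    arith = solveℤ
  ... | inj₂ ne = trans (cong (λ z → eval z c) (charEntry-offDiagonal Xₚ L i j ne)) (cong (λ z → eval z c) (sym (charEntry-offDiagonal (c ∷ []) L i j ne)))

  nonRoot-charDet-const : ∀ L c → NonRootAt c (charDet (c ∷ []) L) → NonRootAt c (charDet Xₚ L)
  nonRoot-charDet-const L c nzc = nonRoot λ e → eval≢0 nzc (trans (sym (eval-det (length L) (charMatrix Xₚ L (length L)) (charMatrix (c ∷ []) L
      (length L)) c (λ a b → eval-charEntry L c (toℕ a) (toℕ b)))) e)

module NSG (k : ℕ) (m n : Fin (suc k) → ℕ) (hm : ∀ i → 1 ≤ m i) (hn : ∀ i → 1 ≤ n i) where

  open CellMatrices k

  cellLabels : Fin (suc k) → List (Label (suc k))
  cellLabels i = replicate (m i) (uL i) ++ replicate (n i) (vL i)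

  cellBlocks : Fin (suc k) → List Block
  cellBlocks i = (uL i , m i ∸ 1) ∷ (vL i , n i ∸ 1) ∷ []

  blocksOf : List (Fin (suc k)) → List Block
  blocksOf xs = concatMap cellBlocks xs

  reducedCells : List (Fin (suc k)) → List Cellₖ
  reducedCells xs = map blockCell (blocksOf xs)

  map-unitCell-replicate : ∀ ℓ c (X : List (Label (suc k))) (Y : List Cellₖ) → 1 ≤ c → map unitCell X ≡ Y
    → map unitCell (replicate c ℓ ++ X) ≡ unitCell ℓ ∷ replicate (c ∸ 1) (unitCell ℓ) ++ Y
  map-unitCell-replicate ℓ (suc c) X Y _ e = cong (unitCell ℓ ∷_) (trans (LP.map-++ unitCell (replicate c ℓ) X) (cong₂ _++_ (LP.map-replicate unitCell c ℓ) e))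

  unitCells≡expandBlocks : ∀ xs → (∀ i → 1 ≤ m i) → (∀ i → 1 ≤ n i) → map unitCell (concatMap cellLabels xs) ≡ expandBlocks (blocksOf xs)
  unitCells≡expandBlocks [] hm hn = refl
  unitCells≡expandBlocks (x ∷ xs) hm hn = trans (cong (map unitCell) (LP.++-assoc (replicate (m x) (uL x)) (replicate (n x) (vL x)) (concatMap cellLabels xs)))
    (map-unitCell-replicate (uL x) (m x) _ _ (hm x) (map-unitCell-replicate (vL x) (n x) _ _ (hn x) (unitCells≡expandBlocks xs hm hn)))

  sumOver : (Fin (suc k) → ℕ) → List (Fin (suc k)) → ℕ
  sumOver f xs = sum (map f xs)

  blockFactor-blocksOf : ∀ xs → blockFactor Xₚ (blocksOf xs) ≈ (Xₚ ^ₚ sumOver (λ i → m i ∸ 1) xs) *ₚ (X+1ₚ ^ₚ sumOver (λ i → n i ∸ 1) xs)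
  blockFactor-blocksOf [] = ≈sym (*-identityˡ 1ₚ)
  blockFactor-blocksOf (x ∷ xs) = begin
    (Xₚ ^ₚ (m x ∸ 1)) *ₚ ((X+1ₚ ^ₚ (n x ∸ 1)) *ₚ blockFactor Xₚ (blocksOf xs))
      ≈⟨ *-congʳ (Xₚ ^ₚ (m x ∸ 1)) (*-congʳ (X+1ₚ ^ₚ (n x ∸ 1)) (blockFactor-blocksOf xs)) ⟩
    (Xₚ ^ₚ (m x ∸ 1)) *ₚ ((X+1ₚ ^ₚ (n x ∸ 1)) *ₚ ((Xₚ ^ₚ A) *ₚ (X+1ₚ ^ₚ B)))
      ≈⟨ interchange (Xₚ ^ₚ (m x ∸ 1)) (X+1ₚ ^ₚ (n x ∸ 1)) (Xₚ ^ₚ A) (X+1ₚ ^ₚ B) ⟩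
    ((Xₚ ^ₚ (m x ∸ 1)) *ₚ (Xₚ ^ₚ A)) *ₚ ((X+1ₚ ^ₚ (n x ∸ 1)) *ₚ (X+1ₚ ^ₚ B))
      ≈⟨ ≈sym (*-cong (^ₚ-+ Xₚ (m x ∸ 1) A) (^ₚ-+ X+1ₚ (n x ∸ 1) B)) ⟩
    (Xₚ ^ₚ ((m x ∸ 1) ℕ.+ A)) *ₚ (X+1ₚ ^ₚ ((n x ∸ 1) ℕ.+ B)) ∎
    where
    interchange : ∀ P Q R S → P *ₚ (Q *ₚ (R *ₚ S)) ≈ (P *ₚ R) *ₚ (Q *ₚ S)
    interchange = RS.solve-∀ poly-almostCommutativeRing
    A = sumOver (λ i → m i ∸ 1) xs
    B = sumOver (λ i → n i ∸ 1) xs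

  AllIndices : (Fin (suc k) → Set) → List Cellₖ → Set
  AllIndices P A = ∀ j → j < length A → P (cellIndex (label (cellAt A j)))

  AllIndices-reducedCells : ∀ (P : Fin (suc k) → Set) xs → All P xs → AllIndices P (reducedCells xs)
  AllIndices-reducedCells P [] [] j ()
  AllIndices-reducedCells P (x ∷ xs) (px ∷ pxs) zero _ = px
  AllIndices-reducedCells P (x ∷ xs) (px ∷ pxs) (suc zero) _ = px
  AllIndices-reducedCells P (x ∷ xs) (px ∷ pxs) (suc (suc j)) (s≤s (s≤s lt)) = AllIndices-reducedCells P xs pxs j lt

  AllIndices-++ : ∀ P (A B : List Cellₖ) → AllIndices P A → AllIndices P B → AllIndices P (A ++ B)
  AllIndices-++ P [] B ha hb = hb
  AllIndices-++ P (a ∷ A) B ha hb zero _ = ha zero (s≤s z≤n)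
  AllIndices-++ P (a ∷ A) B ha hb (suc j) (s≤s lt) = AllIndices-++ P A B (λ j' lt' → ha (suc j') (s≤s lt')) hb j lt

  uWeight : Fin (suc k) → ℤ
  uWeight x = + 1 ℤ.+ + (m x ∸ 1)

  uWeight≢1 : ∀ i → 2 ≤ m i → NotOne (uWeight i)
  uWeight≢1 i 2≤mi w≡1 = ℕP.<-irrefl (sym mi∸1≡0) (ℕP.∸-monoˡ-≤ 1 2≤mi)
    where
    mi∸1≡0 : m i ∸ 1 ≡ 0
    mi∸1≡0 = ℕP.suc-injective (ℤP.+-injective (trans (ℤP.pos-+ 1 (m i ∸ 1)) w≡1))

  1+n≢0 : ∀ t → ¬ (+ 1 ℤ.+ + t ≡ + 0)
  1+n≢0 t e with trans (ℤP.pos-+ 1 t) e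
  ... | ()

  reduced-reducedCells : ∀ Q xs tail → Increasing xs → All (λ y → AllAfter y tail) xs → Reduced Q tail
    → (tail ≡ [] → Last (λ x → Q (uWeight x)) xs) → Reduced Q (reducedCells xs ++ tail)
  reduced-reducedCells Q [] tail _ _ gt _ = gt
  reduced-reducedCells Q (x ∷ xs) tail (ax , ixs) (lx ∷ lxs) gt lp =
    pair x (uWeight x) (+ 0 ℤ.+ + 0 ℤ.* + (m x ∸ 1)) (+ 1 ℤ.+ + (n x ∸ 1)) (+ 0 ℤ.+ + 1 ℤ.* + (n x ∸ 1)) (reducedCells xs ++ tail)
      (arith₁ (+ (m x ∸ 1))) (arith₂ (+ (n x ∸ 1))) (1+n≢0 _) (1+n≢0 _) (endq xs tail lp)
      (AllIndices-++ (λ y → toℕ x < toℕ y) (reducedCells xs) tail (AllIndices-reducedCells _ xs ax) lx)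
      (reduced-reducedCells Q xs tail ixs lxs gt (λ e → lastTail xs e (lp e)))
    where
    arith₁ : ∀ t → + 0 ℤ.+ + 0 ℤ.* t ≡ + 0
    arith₁ = solveℤ
    arith₂ : ∀ t → + 0 ℤ.+ + 1 ℤ.* t ℤ.+ + 1 ≡ + 1 ℤ.+ t
    arith₂ = solveℤ
    lastTail : ∀ ys → tail ≡ [] → Last (λ x → Q (uWeight x)) (x ∷ ys) → Last (λ x → Q (uWeight x)) ys
    lastTail [] _ _ = tt
    lastTail (y ∷ ys) _ l = l
    endq : ∀ ys rest → (rest ≡ [] → Last (λ x → Q (uWeight x)) (x ∷ ys)) → IfLast Q (reducedCells ys ++ rest) (uWeight x)
    endq [] [] l = l refl
    endq [] (_ ∷ _) l = tt
    endq (y ∷ ys) rest l = tt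

  xs : List (Fin (suc k))
  xs = allFin (suc k)
  vertexLabels : List (Label (suc k))
  vertexLabels = labels (suc k) m n
  order : ℕ
  order = nsgOrder (suc k) m n
  unitCells : List Cellₖ
  unitCells = map unitCell vertexLabels
  Σm∸1 Σn∸1 : ℕ
  Σm∸1 = sumFin (λ i → m i ∸ 1)
  Σn∸1 = sumFin (λ i → n i ∸ 1)

  cellAt-map : ∀ (ys : List (Label (suc k))) (a : Fin (length ys)) → cellAt (map unitCell ys) (toℕ a) ≡ unitCell (lookup ys a)
  cellAt-map (y ∷ ys) fz = refl
  cellAt-map (y ∷ ys) (fs a) = cellAt-map ys a

  charPoly-entry : ∀ (a b : Fin order) →
    (if does (a Fin.≟ b) then (- (if does (a Fin.≟ b) then + 0 else adjL (lookup vertexLabels a) (lookup vertexLabels b))) ∷ + 1 ∷ []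
     else (- (if does (a Fin.≟ b) then + 0 else adjL (lookup vertexLabels a) (lookup vertexLabels b))) ∷ [])
    ≈ charEntry Xₚ unitCells (toℕ a) (toℕ b)
  charPoly-entry a b with a Fin.≟ b
  ... | yes refl = ≈sym (≈trans (≡⇒≈ (trans (charEntry-diagonal Xₚ unitCells (toℕ a)) (cong (diagonalEntry Xₚ) (cellAt-map vertexLabels a))))
      (mk λ { zero → refl ; (suc zero) → refl ; (suc (suc i)) → refl }))
  ... | no ne = ≈sym (≈trans (≡⇒≈ (trans (charEntry-offDiagonal Xₚ unitCells (toℕ a) (toℕ b) (λ e → ne (toℕ-injective e))) (cong₂ offDiagonalEntry
      (cellAt-map vertexLabels a) (cellAt-map vertexLabels b))))
                  (const-cong (cong -_ (ℤP.*-identityˡ _))))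

  length-unitCells : length unitCells ≡ order
  length-unitCells = LP.length-map unitCell vertexLabels

  charPoly≈charDet : charPoly order (nsgAdj (suc k) m n) ≈ charDet Xₚ unitCells
  charPoly≈charDet = ≈trans (det-cong order charPoly-entry) (≡⇒≈ (sym (charDet-length Xₚ unitCells order length-unitCells)))

  charPoly-factorised : charPoly order (nsgAdj (suc k) m n) ≈ ((Xₚ ^ₚ Σm∸1) *ₚ (X+1ₚ ^ₚ Σn∸1)) *ₚ charDet Xₚ (reducedCells xs)
  charPoly-factorised = ≈trans charPoly≈charDet (≈trans (≡⇒≈ (cong (charDet Xₚ) (unitCells≡expandBlocks xs hm hn))) (≈trans
      (charDet-expandBlocks Xₚ [] (blocksOf xs)) (*-congˡ (charDet Xₚ (reducedCells xs)) (blockFactor-blocksOf xs))))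

  increasing-all : Increasing xs
  increasing-all = Increasing-tabulate id (λ a b lt → lt)

  allAfter-[] : ∀ (ys : List (Fin (suc k))) → All (λ y → AllAfter y []) ys
  allAfter-[] [] = []
  allAfter-[] (y ∷ ys) = (λ j ()) ∷ allAfter-[] ys

  reduced-all : ∀ (Q : ℤ → Set) → Q (uWeight (fromℕ k)) → Reduced Q (reducedCells xs)
  reduced-all Q q = subst (Reduced Q) (LP.++-identityʳ (reducedCells xs)) (reduced-reducedCells Q xs [] increasing-all (allAfter-[] xs) done
      (λ _ → Last-tabulate k (λ x → Q (uWeight x)) id q))

  nonRoot0-reducedCells : NonRootAt (+ 0) (charDet Xₚ (reducedCells xs))
  nonRoot0-reducedCells = nonRoot-charDet-const (reducedCells xs) (+ 0) (nonRoot0-reduced (reducedCells xs) (reduced-all (λ _ → ⊤) tt))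

  mul0 : EigMult order (nsgAdj (suc k) m n) (+ 0) Σm∸1
  mul0 = eigMult-intro order (nsgAdj (suc k) m n) (+ 0) Σm∸1 _
    (≈trans charPoly-factorised (*-assoc (Xₚ ^ₚ Σm∸1) (X+1ₚ ^ₚ Σn∸1) (charDet Xₚ (reducedCells xs))))
    (NonRootAt-* (NonRootAt-^ Σn∸1 (nonRoot λ ())) nonRoot0-reducedCells)

  lastIdx : Fin (suc k)
  lastIdx = fromℕ k

  nonRoot-1-X^ : NonRootAt (- (+ 1)) (Xₚ ^ₚ Σm∸1)
  nonRoot-1-X^ = NonRootAt-^ Σm∸1 (nonRoot λ ())

  mul-1-lastU≥2 : NotOne (uWeight lastIdx) → EigMult order (nsgAdj (suc k) m n) (- (+ 1)) Σn∸1
  mul-1-lastU≥2 lastNotOne = eigMult-intro order (nsgAdj (suc k) m n) (- (+ 1)) Σn∸1 _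
    (≈trans charPoly-factorised (*-leftComm (Xₚ ^ₚ Σm∸1) (X+1ₚ ^ₚ Σn∸1) (charDet Xₚ (reducedCells xs))))
    (NonRootAt-* nonRoot-1-X^ (nonRoot-charDet-const (reducedCells xs) (- (+ 1)) (nonRoot-1-reduced (reducedCells xs) (reduced-all NotOne lastNotOne))))
    where
    *-leftComm : ∀ A B C → (A *ₚ B) *ₚ C ≈ B *ₚ (A *ₚ C)
    *-leftComm = RS.solve-∀ poly-almostCommutativeRing

  toℕ-lastIdx : toℕ lastIdx ≡ k
  toℕ-lastIdx = toℕ-fromℕ k

  twins-earlier : ∀ e → toℕ (cellIndex (label e)) < k → Twins (uL lastIdx) (vL lastIdx) e
  twins-earlier (cell (uL j) w d) lt rewrite >⇒≤ᵇ≡false {toℕ lastIdx} {toℕ j} (subst (toℕ j <_) (sym toℕ-lastIdx) lt) = refl , refl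
  twins-earlier (cell (vL j) w d) lt rewrite ≤⇒≤ᵇ≡true {toℕ j} {toℕ lastIdx} (ℕP.<⇒≤ (subst (toℕ j <_) (sym toℕ-lastIdx) lt)) = refl , refl

  ys : List (Fin (suc k))
  ys = tabulate inject₁

  allFin-snoc : xs ≡ ys ++ lastIdx ∷ []
  allFin-snoc = tabulate-snoc k id

  tm tn : ℕ
  tm = m lastIdx ∸ 1
  tn = n lastIdx ∸ 1
  w1 d1 w2 d2 : ℤ
  w1 = + 1 ℤ.+ + tm
  d1 = + 0 ℤ.+ + 0 ℤ.* + tm
  w2 = + 1 ℤ.+ + tn
  d2 = + 0 ℤ.+ + 1 ℤ.* + tn

  reducedCells-snoc : reducedCells xs ≡ reducedCells ys ++ cell (uL lastIdx) w1 d1 ∷ cell (vL lastIdx) w2 d2 ∷ []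
  reducedCells-snoc = trans (cong reducedCells allFin-snoc) (trans (cong (map blockCell) (LP.concatMap-++ cellBlocks ys (lastIdx ∷ [])))
      (LP.map-++ blockCell (blocksOf ys) (cellBlocks lastIdx ++ [])))

  increasing-init : Increasing ys
  increasing-init = Increasing-tabulate inject₁ (λ a b lt → subst₂ _<_ (sym (toℕ-inject₁ a)) (sym (toℕ-inject₁ b)) lt)

  init<k : All (λ y → toℕ y < k) ys
  init<k = AllP.tabulate⁺ (λ a → subst (_< k) (sym (toℕ-inject₁ a)) (toℕ<n a))

  mergedWeight mergedLoop : ℤ
  mergedWeight = w1 ℤ.+ w2
  mergedLoop = d2 ℤ.+ + 1 ℤ.* w1

  R′ : List Cellₖ
  R′ = reducedCells ys ++ cell (vL lastIdx) mergedWeight mergedLoop ∷ []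

  charDet-mergeLast : m lastIdx ≡ 1 → charDet Xₚ (reducedCells xs) ≈ X+1ₚ *ₚ charDet Xₚ R′
  charDet-mergeLast eqm = ≈trans (≡⇒≈ (cong (charDet Xₚ) reducedCells-snoc))
    (charDet-mergeTwins Xₚ (reducedCells ys) [] (uL lastIdx) (vL lastIdx) w1 w2 d1 d2 (+ 1) (adjL-u-v lastIdx) (adjL-v-u lastIdx) hd1 (arith (+ tn)) twins)
    where
    hd1 : d1 ℤ.+ + 1 ≡ + 1 ℤ.* w1
    hd1 = subst (λ t → + 0 ℤ.+ + 0 ℤ.* + t ℤ.+ + 1 ≡ + 1 ℤ.* (+ 1 ℤ.+ + t)) (sym (cong (_∸ 1) eqm)) refl
    arith : ∀ t → + 0 ℤ.+ + 1 ℤ.* t ℤ.+ + 1 ≡ + 1 ℤ.* (+ 1 ℤ.+ t)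
    arith = solveℤ
    twins : ∀ i → i < length (reducedCells ys ++ cell (uL lastIdx) w1 d1 ∷ cell (vL lastIdx) w2 d2 ∷ []) → i ≢ length (reducedCells ys) → i ≢ suc
        (length (reducedCells ys))
      → Twins (uL lastIdx) (vL lastIdx) (cellAt (reducedCells ys ++ cell (uL lastIdx) w1 d1 ∷ cell (vL lastIdx) w2 d2 ∷ []) i)
    twins i lt n1 n2 = subst (Twins (uL lastIdx) (vL lastIdx)) (sym (cellAt-++ˡ (reducedCells ys) _ i i<))
      (twins-earlier (cellAt (reducedCells ys) i) (AllIndices-reducedCells (λ y → toℕ y < k) ys init<k i i<))
      where
      i< : i < length (reducedCells ys)
      i< = <+2⇒< (subst (i <_) (LP.length-++ (reducedCells ys)) lt) n1 n2

  reduced-R′ : Reduced NotOne R′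
  reduced-R′ = reduced-reducedCells NotOne ys (cell (vL lastIdx) mergedWeight mergedLoop ∷ []) increasing-init allAfter-lastV
    (lone lastIdx mergedWeight mergedLoop (arith₁ (+ tn) (+ tm)) mergedWeight≢0 mergedLoop≢0) (λ ())
    where
    arith₁ : ∀ a b → + 0 ℤ.+ + 1 ℤ.* a ℤ.+ + 1 ℤ.* (+ 1 ℤ.+ b) ℤ.+ + 1 ≡ (+ 1 ℤ.+ b) ℤ.+ (+ 1 ℤ.+ a)
    arith₁ = solveℤ
    arith₂ : ∀ a b → + 0 ℤ.+ + 1 ℤ.* a ℤ.+ + 1 ℤ.* (+ 1 ℤ.+ b) ≡ + 1 ℤ.+ (a ℤ.+ b)
    arith₂ = solveℤ
    mergedWeight≢0 : ¬ (mergedWeight ≡ + 0)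
    mergedWeight≢0 e with trans (sym (ℤP.pos-+ (suc tm) (suc tn))) (trans (sym (cong₂ ℤ._+_ (ℤP.pos-+ 1 tm) (ℤP.pos-+ 1 tn))) e)
    ... | ()
    mergedLoop≢0 : ¬ (mergedLoop ≡ + 0)
    mergedLoop≢0 e with trans (sym (trans (cong (λ z → + 1 ℤ.+ z) (sym (ℤP.pos-+ tn tm))) (sym (ℤP.pos-+ 1 (tn ℕ.+ tm))))) (trans (sym (arith₂ (+ tn) (+ tm))) e)
    ... | ()
    allAfter-lastV : All (λ y → AllAfter y (cell (vL lastIdx) mergedWeight mergedLoop ∷ [])) ys
    allAfter-lastV = All.map (λ {y} y<k → λ { zero _ → subst (toℕ y <_) (sym toℕ-lastIdx) y<k ; (suc j) (s≤s ()) }) init<k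

  mul-1-lastU≡1 : m lastIdx ≡ 1 → EigMult order (nsgAdj (suc k) m n) (- (+ 1)) (Σn∸1 + 1)
  mul-1-lastU≡1 eqm = eigMult-intro order (nsgAdj (suc k) m n) (- (+ 1)) (Σn∸1 + 1) ((Xₚ ^ₚ Σm∸1) *ₚ charDet Xₚ R′) factorisation
    (NonRootAt-* nonRoot-1-X^ (nonRoot-charDet-const R′ (- (+ 1)) (nonRoot-1-reduced R′ reduced-R′)))
    where
    *-regroup : ∀ A B C D → (A *ₚ B) *ₚ (C *ₚ D) ≈ (B *ₚ (C *ₚ 1ₚ)) *ₚ (A *ₚ D)
    *-regroup = RS.solve-∀ poly-almostCommutativeRing
    factorisation : charPoly order (nsgAdj (suc k) m n) ≈ (X+1ₚ ^ₚ (Σn∸1 + 1)) *ₚ ((Xₚ ^ₚ Σm∸1) *ₚ charDet Xₚ R′)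
    factorisation = begin
      charPoly order (nsgAdj (suc k) m n) ≈⟨ charPoly-factorised ⟩
      ((Xₚ ^ₚ Σm∸1) *ₚ (X+1ₚ ^ₚ Σn∸1)) *ₚ charDet Xₚ (reducedCells xs) ≈⟨ *-congʳ ((Xₚ ^ₚ Σm∸1) *ₚ (X+1ₚ ^ₚ Σn∸1)) (charDet-mergeLast eqm) ⟩
      ((Xₚ ^ₚ Σm∸1) *ₚ (X+1ₚ ^ₚ Σn∸1)) *ₚ (X+1ₚ *ₚ charDet Xₚ R′) ≈⟨ *-regroup (Xₚ ^ₚ Σm∸1) (X+1ₚ ^ₚ Σn∸1) X+1ₚ (charDet Xₚ R′) ⟩
      ((X+1ₚ ^ₚ Σn∸1) *ₚ (X+1ₚ ^ₚ 1)) *ₚ ((Xₚ ^ₚ Σm∸1) *ₚ charDet Xₚ R′) ≈⟨ *-congˡ ((Xₚ ^ₚ Σm∸1) *ₚ charDet Xₚ R′) (≈sym (^ₚ-+ X+1ₚ Σn∸1 1)) ⟩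
      (X+1ₚ ^ₚ (Σn∸1 + 1)) *ₚ ((Xₚ ^ₚ Σm∸1) *ₚ charDet Xₚ R′) ∎

lemma3p2 : (k : ℕ) (m n : Fin (suc k) → ℕ) →
    (∀ i → 1 ≤ m i) → (∀ i → 1 ≤ n i) →
    EigMult (nsgOrder (suc k) m n) (nsgAdj (suc k) m n) (+ 0)
      (sumFin (λ i → m i ∸ 1))
    × EigMult (nsgOrder (suc k) m n) (nsgAdj (suc k) m n) (- (+ 1))
      (sumFin (λ i → n i ∸ 1) + (if m (fromℕ k) ≡ᵇ 1 then 1 else 0))
lemma3p2 k m n hm hn = NSG.mul0 k m n hm hn , mul-1
  where
  mul-1 : EigMult (nsgOrder (suc k) m n) (nsgAdj (suc k) m n) (- (+ 1))
      (sumFin (λ i → n i ∸ 1) + (if m (fromℕ k) ≡ᵇ 1 then 1 else 0))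
  mul-1 with m (fromℕ k) in eq | hm (fromℕ k)
  ... | suc zero | _ = NSG.mul-1-lastU≡1 k m n hm hn eq
  ... | suc (suc t) | _ rewrite ℕP.+-identityʳ (sumFin (λ i → n i ∸ 1)) =
    NSG.mul-1-lastU≥2 k m n hm hn (NSG.uWeight≢1 k m n hm hn (fromℕ k) (subst (2 ≤_) (sym eq) (s≤s (s≤s z≤n))))
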